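{- For each calculus $\mathsf{S}\in\{\mathsf{S.ConstCKID},\mathsf{S.ConstCKMP},\mathsf{S.ConstCKMPID}\}$: the rules $\mathsf{w_L}$: $\Gamma\Rightarrow\Delta$ / $\Gamma,\varphi\Rightarrow\Delta$; $\mathsf{w_R}$: $\Gamma\Rightarrow$ / $\Gamma\Rightarrow\varphi$; $\mathsf{c}$: $\Gamma,\varphi,\varphi\Rightarrow\Delta$ / $\Gamma,\varphi\Rightarrow\Delta$ are height-preserving admissible in $\mathsf{S}$, and the rule $\mathsf{cut}$: $\Gamma\Rightarrow\varphi$, $\Gamma',\varphi\Rightarrow\Delta$ / $\Gamma,\Gamma'\Rightarrow\Delta$ is admissible in $\mathsf{S}$.
   Context: $\mathcal{L}$: formulas $\varphi ::= p \mid \bot \mid \varphi\wedge\varphi \mid \varphi\vee\varphi \mid \varphi\to\varphi \mid \varphi \mathbin{\Box\!\!\rightarrow} \varphi \mid \varphi \mathbin{\Diamond\!\!\rightarrow}\varphi$. Sequents $\Gamma\Rightarrow\Delta$: finite multisets, $|\Delta|\le1$; $\varphi\Leftrightarrow\rho$ abbreviates the two sequents $\varphi\Rightarrow\rho$, $\rho\Rightarrow\varphi$. Throughout $|\Delta|\le1$, $n\ge0$. Propositional rules: init: $\Gamma,p\Rightarrow p$; $\bot_L$: $\Gamma,\bot\Rightarrow\Delta$; $\wedge_L$: $\Gamma,\varphi,\psi\Rightarrow\Delta$ / $\Gamma,\varphi\wedge\psi\Rightarrow\Delta$; $\wedge_R$: $\Gamma\Rightarrow\varphi$, $\Gamma\Rightarrow\psi$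 / $\Gamma\Rightarrow\varphi\wedge\psi$; $\vee_L$: $\Gamma,\varphi\Rightarrow\Delta$, $\Gamma,\psi\Rightarrow\Delta$ / $\Gamma,\varphi\vee\psi\Rightarrow\Delta$; $\vee_R^1$: $\Gamma\Rightarrow\varphi$ / $\Gamma\Rightarrow\varphi\vee\psi$; $\vee_R^2$: $\Gamma\Rightarrow\psi$ / $\Gamma\Rightarrow\varphi\vee\psi$; $\to_R$: $\Gamma,\varphi\Rightarrow\psi$ / $\Gamma\Rightarrow\varphi\to\psi$; $\to_L$: $\Gamma,\varphi\to\psi\Rightarrow\varphi$, $\Gamma,\psi\Rightarrow\Delta$ / $\Gamma,\varphi\to\psi\Rightarrow\Delta$. Write $P=\rho_1\mathbin{\Box\!\!\rightarrow}\sigma_1,\dots,\rho_n\mathbin{\Box\!\!\rightarrow}\sigma_n$. Conditional rules: $\Box$: $\{\varphi\Leftrightarrow\rho_i\}_{i\le n}$, $\sigma_1,\dots,\sigma_n\Rightarrow\psi$ / $\Gamma,P\Rightarrow\varphi\mathbin{\Box\!\!\rightarrow}\psi$; $\Diamond$: $\{\varphi\Leftrightarrow\rho_i\}_{i\le n}$, $\varphi\Leftrightarrow\eta$, $\sigma_1,\dots,\sigma_n,\psi\Rightarrow\vartheta$ / $\Gamma,P,\varphi\mathbin{\Diamond\!\!\rightarrow}\psi\Rightarrow\eta\mathbin{\Diamond\!\!\rightarrow}\vartheta$; $\Box\Diamond$: $\{\varphi\Leftrightarrow\rho_i\}_{i\le n}$, $\sigma_1,\dots,\sigma_n,\psi\Rightarrow$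 / $\Gamma,P,\varphi\mathbin{\Diamond\!\!\rightarrow}\psi\Rightarrow\Delta$; $\Box^{id}$: $\{\varphi\Leftrightarrow\rho_i\}_{i\le n}$, $\sigma_1,\dots,\sigma_n,\varphi\Rightarrow\psi$ / $\Gamma,P\Rightarrow\varphi\mathbin{\Box\!\!\rightarrow}\psi$; $\Diamond^{id}$: $\{\varphi\Leftrightarrow\rho_i\}_{i\le n}$, $\varphi\Leftrightarrow\eta$, $\sigma_1,\dots,\sigma_n,\varphi,\psi\Rightarrow\vartheta$ / $\Gamma,P,\varphi\mathbin{\Diamond\!\!\rightarrow}\psi\Rightarrow\eta\mathbin{\Diamond\!\!\rightarrow}\vartheta$; $\Box\Diamond^{id}$: $\{\varphi\Leftrightarrow\rho_i\}_{i\le n}$, $\sigma_1,\dots,\sigma_n,\varphi,\psi\Rightarrow$ / $\Gamma,P,\varphi\mathbin{\Diamond\!\!\rightarrow}\psi\Rightarrow\Delta$; $mp_\Box$: $\Gamma,\varphi\mathbin{\Box\!\!\rightarrow}\psi\Rightarrow\varphi$, $\Gamma,\varphi\mathbin{\Box\!\!\rightarrow}\psi,\psi\Rightarrow\Delta$ / $\Gamma,\varphi\mathbin{\Box\!\!\rightarrow}\psi\Rightarrow\Delta$; $mp_\Diamond$: $\Gamma\Rightarrow\varphi$, $\Gamma\Rightarrow\psi$ / $\Gamma\Rightarrow\varphi\mathbin{\Diamond\!\!\rightarrow}\psi$. Calculi (propositional rules plus): $\mathsf{S.ConstCKID}$: $\Box^{id},\Diamond^{id},\Box\Diamond^{id}$;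 $\mathsf{S.ConstCKMP}$: $\Box,\Diamond,\Box\Diamond,mp_\Box,mp_\Diamond$; $\mathsf{S.ConstCKMPID}$: $\Box^{id},\Diamond^{id},\Box\Diamond^{id},mp_\Box,mp_\Diamond$. Height of a derivation: length of its longest branch minus 1. Height-preserving admissible: whenever the premiss has a derivation of height $\le h$, the conclusion has one of height $\le h$. Admissible: derivability of the premisses implies derivability of the conclusion. -}

module Defs where

open import Data.Nat using (ℕ; zero; suc)
open import Data.List using (List; []; _∷_; _++_; [_]; map)
open import Data.List.Relation.Unary.All using (All)
open import Data.List.Relation.Binary.Permutation.Propositional using (_↭_)
open import Data.Maybe using (Maybe; just; nothing)
open import Data.Product using (_×_; _,_; proj₁; proj₂; ∃)

infixr 40 _∧'_
infixr 35 _∨'_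
infixr 30 _⊃_ _□→_ _◇→_

data Fm : Set where
  var  : ℕ → Fm
  ⊥'   : Fm
  _∧'_ : Fm → Fm → Fm
  _∨'_ : Fm → Fm → Fm
  _⊃_  : Fm → Fm → Fm
  _□→_ : Fm → Fm → Fm
  _◇→_ : Fm → Fm → Fm

-- Antecedents are finite multisets, represented by lists; every rule
-- conclusion is taken up to permutation (_↭_), so derivability is
-- a property of the underlying multiset.
Ctx : Set
Ctx = List Fm

Succ : Set
Succ = Maybe Fm

data Calculus : Set where
  ConstCKID ConstCKMP ConstCKMPID : Calculus

data HasPlain : Calculus → Set where
  plain-MP : HasPlain ConstCKMP

data HasId : Calculus → Set where
  id-ID   : HasId ConstCKID
  id-MPID : HasId ConstCKMPID

data HasMP : Calculus → Set where
  mp-MP   : HasMP ConstCKMP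
  mp-MPID : HasMP ConstCKMPID

-- P = ρ₁ □→ σ₁, …, ρₙ □→ σₙ is given by the list of pairs (ρᵢ , σᵢ)
boxes : List (Fm × Fm) → Ctx
boxes = map (λ p → proj₁ p □→ proj₂ p)

conseqs : List (Fm × Fm) → Ctx
conseqs = map proj₂

-- S ⊢[ h ] Γ ⇒ Δ : the sequent Γ ⇒ Δ has an S-derivation of height ≤ h
-- (height = length of longest branch minus 1, so initial sequents have height 0).
data _⊢[_]_⇒_ (S : Calculus) : ℕ → Ctx → Succ → Set

Equivs : Calculus → ℕ → Fm → List (Fm × Fm) → Set
Equivs S h φ P = All (λ p → (S ⊢[ h ] [ φ ] ⇒ just (proj₁ p)) × (S ⊢[ h ] [ proj₁ p ] ⇒ just φ)) P

data _⊢[_]_⇒_ S where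
  init : ∀ {h Θ Γ p} → Θ ↭ var p ∷ Γ → S ⊢[ h ] Θ ⇒ just (var p)
  ⊥L   : ∀ {h Θ Γ Δ} → Θ ↭ ⊥' ∷ Γ → S ⊢[ h ] Θ ⇒ Δ
  ∧L   : ∀ {h Θ Γ Δ φ ψ} → Θ ↭ (φ ∧' ψ) ∷ Γ →
         S ⊢[ h ] φ ∷ ψ ∷ Γ ⇒ Δ → S ⊢[ suc h ] Θ ⇒ Δ
  ∧R   : ∀ {h Θ φ ψ} → S ⊢[ h ] Θ ⇒ just φ → S ⊢[ h ] Θ ⇒ just ψ →
         S ⊢[ suc h ] Θ ⇒ just (φ ∧' ψ)
  ∨L   : ∀ {h Θ Γ Δ φ ψ} → Θ ↭ (φ ∨' ψ) ∷ Γ →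
         S ⊢[ h ] φ ∷ Γ ⇒ Δ → S ⊢[ h ] ψ ∷ Γ ⇒ Δ → S ⊢[ suc h ] Θ ⇒ Δ
  ∨R₁  : ∀ {h Θ φ ψ} → S ⊢[ h ] Θ ⇒ just φ → S ⊢[ suc h ] Θ ⇒ just (φ ∨' ψ)
  ∨R₂  : ∀ {h Θ φ ψ} → S ⊢[ h ] Θ ⇒ just ψ → S ⊢[ suc h ] Θ ⇒ just (φ ∨' ψ)
  ⊃R   : ∀ {h Θ φ ψ} → S ⊢[ h ] φ ∷ Θ ⇒ just ψ → S ⊢[ suc h ] Θ ⇒ just (φ ⊃ ψ)
  ⊃L   : ∀ {h Θ Γ Δ φ ψ} → Θ ↭ (φ ⊃ ψ) ∷ Γ →
         S ⊢[ h ] Θ ⇒ just φ → S ⊢[ h ] ψ ∷ Γ ⇒ Δ → S ⊢[ suc h ] Θ ⇒ Δ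
  □R   : ∀ {h Θ Γ P φ ψ} → HasPlain S → Θ ↭ Γ ++ boxes P →
         Equivs S h φ P → S ⊢[ h ] conseqs P ⇒ just ψ →
         S ⊢[ suc h ] Θ ⇒ just (φ □→ ψ)
  ◇R   : ∀ {h Θ Γ P φ ψ η ϑ} → HasPlain S → Θ ↭ (φ ◇→ ψ) ∷ (Γ ++ boxes P) →
         Equivs S h φ P → S ⊢[ h ] [ φ ] ⇒ just η → S ⊢[ h ] [ η ] ⇒ just φ →
         S ⊢[ h ] ψ ∷ conseqs P ⇒ just ϑ →
         S ⊢[ suc h ] Θ ⇒ just (η ◇→ ϑ)
  □◇   : ∀ {h Θ Γ Δ P φ ψ} → HasPlain S → Θ ↭ (φ ◇→ ψ) ∷ (Γ ++ boxes P) →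
         Equivs S h φ P → S ⊢[ h ] ψ ∷ conseqs P ⇒ nothing →
         S ⊢[ suc h ] Θ ⇒ Δ
  □Rid : ∀ {h Θ Γ P φ ψ} → HasId S → Θ ↭ Γ ++ boxes P →
         Equivs S h φ P → S ⊢[ h ] φ ∷ conseqs P ⇒ just ψ →
         S ⊢[ suc h ] Θ ⇒ just (φ □→ ψ)
  ◇Rid : ∀ {h Θ Γ P φ ψ η ϑ} → HasId S → Θ ↭ (φ ◇→ ψ) ∷ (Γ ++ boxes P) →
         Equivs S h φ P → S ⊢[ h ] [ φ ] ⇒ just η → S ⊢[ h ] [ η ] ⇒ just φ →
         S ⊢[ h ] φ ∷ ψ ∷ conseqs P ⇒ just ϑ →
         S ⊢[ suc h ] Θ ⇒ just (η ◇→ ϑ)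
  □◇id : ∀ {h Θ Γ Δ P φ ψ} → HasId S → Θ ↭ (φ ◇→ ψ) ∷ (Γ ++ boxes P) →
         Equivs S h φ P → S ⊢[ h ] φ ∷ ψ ∷ conseqs P ⇒ nothing →
         S ⊢[ suc h ] Θ ⇒ Δ
  mp□  : ∀ {h Θ Γ Δ φ ψ} → HasMP S → Θ ↭ (φ □→ ψ) ∷ Γ →
         S ⊢[ h ] Θ ⇒ just φ → S ⊢[ h ] ψ ∷ Θ ⇒ Δ → S ⊢[ suc h ] Θ ⇒ Δ
  mp◇  : ∀ {h Θ φ ψ} → HasMP S →
         S ⊢[ h ] Θ ⇒ just φ → S ⊢[ h ] Θ ⇒ just ψ →
         S ⊢[ suc h ] Θ ⇒ just (φ ◇→ ψ)

_⊢_⇒_ : Calculus → Ctx → Succ → Set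
S ⊢ Γ ⇒ Δ = ∃ λ h → S ⊢[ h ] Γ ⇒ Δ

HP-wL : Calculus → Set
HP-wL S = ∀ h Γ Δ φ → S ⊢[ h ] Γ ⇒ Δ → S ⊢[ h ] φ ∷ Γ ⇒ Δ

HP-wR : Calculus → Set
HP-wR S = ∀ h Γ φ → S ⊢[ h ] Γ ⇒ nothing → S ⊢[ h ] Γ ⇒ just φ

HP-c : Calculus → Set
HP-c S = ∀ h Γ Δ φ → S ⊢[ h ] φ ∷ φ ∷ Γ ⇒ Δ → S ⊢[ h ] φ ∷ Γ ⇒ Δ

Adm-cut : Calculus → Set
Adm-cut S = ∀ Γ Γ' Δ φ → S ⊢ Γ ⇒ just φ → S ⊢ φ ∷ Γ' ⇒ Δ → S ⊢ Γ ++ Γ' ⇒ Δ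

module Submission where

-- Weakening goes through by induction on the derivation, because every
-- conditional rule carries an arbitrary side context Γ. Contraction uses
-- height-preserving inversion of ∧L, ∨L and of the right premiss of ⊃L; a
-- contracted box ρ □→ σ in the P of a conditional rule is handled by
-- dropping one copy of its equivalence premisses and contracting σ above.
-- Cut is proved by induction on the cut formula and, inside it, on the two
-- derivations: the cut moves up the left derivation until the cut formula is
-- introduced on the right, then up the right one until it is principal. An
-- introduced A □→ B occurring in the P of another conditional rule is merged
-- into that P (equivalences compose by a cut on A, consequents by a cut on
-- B); used by mp□, it is replaced by firing the boxes of its own P with mp□.
-- A might-conditional introduced by mp◇ meets ◇R or □◇ in the same way, by
-- firing the boxes of their P.

open import Defs
open import Algebra.Bundles using (CommutativeMonoid)
open import Data.Empty using (⊥; ⊥-elim)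
open import Data.Unit using (⊤)
open import Data.List using (List; []; _∷_; _++_; [_])
open import Data.List.Properties using (map-++)
open import Data.List.Membership.Propositional using (_∈_)
open import Data.List.Membership.Propositional.Properties using (∈-∃++; ∈-map⁻; ∈-++⁻)
open import Data.List.Relation.Binary.Permutation.Propositional
open import Data.List.Relation.Binary.Permutation.Propositional.Properties
open import Data.List.Relation.Unary.All as All using (All; []; _∷_)
open import Data.List.Relation.Unary.All.Properties as All using ()
open import Data.List.Relation.Unary.Any using (here; there)
open import Data.Maybe using (just; nothing)
open import Data.Nat using (ℕ; suc; _≤_; _⊔_; s≤s)
open import Data.Nat.Properties using (≤-refl; ≤-trans; m≤m⊔n; m≤n⊔m; n≤1+n)
open import Data.Product using (_×_; _,_; ∃; proj₁; proj₂)
open import Data.Sum using (_⊎_; inj₁; inj₂)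
open import Relation.Binary.PropositionalEquality using (_≡_; refl; sym; subst)
open import Algebra.Properties.CommutativeSemigroup
  (CommutativeMonoid.commutativeSemigroup (++-commutativeMonoid {A = Fm}))
  using (interchange; xy∙z≈xz∙y)

Eventually : (ℕ → Set) → Set
Eventually F = ∃ λ h → ∀ {k} → h ≤ k → F k

Eventually-map : ∀ {F G : ℕ → Set} → (∀ {k} → F k → G k) → Eventually F → Eventually G
Eventually-map f (h , x) = h , λ q → f (x q)

infixr 4 _⊗_
_⊗_ : ∀ {F G : ℕ → Set} → Eventually F → Eventually G → Eventually (λ k → F k × G k)
(h₁ , f) ⊗ (h₂ , g) = h₁ ⊔ h₂ , λ q → f (≤-trans (m≤m⊔n h₁ h₂) q) , g (≤-trans (m≤n⊔m h₁ h₂) q)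

module _ {A : Set} where

  ↭-sym-trans : ∀ {xs ys zs : List A} → xs ↭ ys → xs ↭ zs → ys ↭ zs
  ↭-sym-trans q p = ↭-trans (↭-sym q) p

  ∈⇒↭∷ : ∀ {x : A} {xs} → x ∈ xs → ∃ λ ys → xs ↭ x ∷ ys
  ∈⇒↭∷ m with ∈-∃++ m
  ... | ys , zs , refl = ys ++ zs , shift _ ys zs

  ∷-insert : ∀ (x : A) {xs y ys} → xs ↭ y ∷ ys → x ∷ xs ↭ y ∷ x ∷ ys
  ∷-insert x p = ↭-trans (prep x p) (swap x _ refl)

  ++-insert : ∀ (zs : List A) {xs y ys} → xs ↭ y ∷ ys → zs ++ xs ↭ y ∷ zs ++ ys
  ++-insert zs {y = y} {ys} p = ↭-trans (++⁺ˡ zs p) (shift y zs ys)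

  ∷↭∷⁻ : ∀ {x y : A} {xs ys} → x ∷ xs ↭ y ∷ ys →
         (x ≡ y × xs ↭ ys) ⊎ (∃ λ zs → xs ↭ y ∷ zs × ys ↭ x ∷ zs)
  ∷↭∷⁻ {x} {y} p with ∈-resp-↭ (↭-sym p) (here refl)
  ... | here refl = inj₁ (refl , drop-∷ p)
  ... | there m with ∈⇒↭∷ m
  ...   | zs , q = inj₂ (zs , q , drop-∷ (↭-trans (↭-sym p) (↭-trans (prep x q) (swap x y refl))))

  ∷∷↭∷⁻ : ∀ {x y : A} {xs ys} → x ∷ x ∷ xs ↭ y ∷ ys →
          (x ≡ y × ys ↭ x ∷ xs) ⊎ (∃ λ zs → xs ↭ y ∷ zs × ys ↭ x ∷ x ∷ zs)
  ∷∷↭∷⁻ {x} p with ∷↭∷⁻ p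
  ... | inj₁ (e , q) = inj₁ (e , ↭-sym q)
  ... | inj₂ (zs , q₁ , q₂) with ∷↭∷⁻ q₁
  ...   | inj₁ (refl , r) = inj₁ (refl , ↭-trans q₂ (prep x (↭-sym r)))
  ...   | inj₂ (zs′ , r₁ , r₂) = inj₂ (zs′ , r₁ , ↭-trans q₂ (prep x r₂))

  ∷∷↭∷⇒∷↭∷ : ∀ {x y : A} {xs ys} → x ∷ x ∷ xs ↭ y ∷ ys → ∃ λ zs → x ∷ xs ↭ y ∷ zs
  ∷∷↭∷⇒∷↭∷ {x} {xs = xs} c with ∷∷↭∷⁻ c
  ... | inj₁ (refl , _) = xs , ↭-refl
  ... | inj₂ (zs , r , _) = x ∷ zs , ∷-insert x r

-- "Boxed" in the names below refers to an antecedent Γ ++ boxes P, the shape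
-- of the conclusion of every conditional rule.

NotBox : Fm → Set
NotBox χ = ∀ {ρ σ} → χ ≡ ρ □→ σ → ⊥

boxes-↭ : ∀ {P Q} → P ↭ Q → boxes P ↭ boxes Q
boxes-↭ = map⁺ _

conseqs-↭ : ∀ {P Q} → P ↭ Q → conseqs P ↭ conseqs Q
conseqs-↭ = map⁺ _

∈-boxes⁻ : ∀ {χ} P → χ ∈ boxes P → ∃ λ ρ → ∃ λ σ → ∃ λ P₀ → χ ≡ ρ □→ σ × P ↭ (ρ , σ) ∷ P₀
∈-boxes⁻ P m with ∈-map⁻ _ m
... | (ρ , σ) , m′ , refl with ∈⇒↭∷ m′
...   | P₀ , q = ρ , σ , P₀ , refl , q

∷↭boxed⁻ : ∀ {φ Γ Gc P} → φ ∷ Γ ↭ Gc ++ boxes P →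
           (∃ λ G₀ → Γ ↭ G₀ ++ boxes P) ⊎
           (∃ λ ρ → ∃ λ σ → ∃ λ P₀ → φ ≡ ρ □→ σ × P ↭ (ρ , σ) ∷ P₀ × Γ ↭ Gc ++ boxes P₀)
∷↭boxed⁻ {Gc = Gc} {P} p with ∈-++⁻ Gc (∈-resp-↭ p (here refl))
... | inj₁ m with ∈⇒↭∷ m
...   | G₀ , q = inj₁ (G₀ , drop-∷ (↭-trans p (++⁺ʳ _ q)))
∷↭boxed⁻ {Gc = Gc} {P} p | inj₂ m with ∈-boxes⁻ P m
...   | ρ , σ , P₀ , refl , q =
  inj₂ (ρ , σ , P₀ , refl , q , drop-∷ (↭-trans p (↭-trans (++⁺ˡ Gc (boxes-↭ q)) (shift _ Gc _))))

∷↭◇boxed⁻ : ∀ {φ Γ χ Gc P} → φ ∷ Γ ↭ χ ∷ (Gc ++ boxes P) →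
            (φ ≡ χ × Γ ↭ Gc ++ boxes P) ⊎
            ((∃ λ G₀ → Γ ↭ χ ∷ (G₀ ++ boxes P)) ⊎
             (∃ λ ρ → ∃ λ σ → ∃ λ P₀ → φ ≡ ρ □→ σ × P ↭ (ρ , σ) ∷ P₀ × Γ ↭ χ ∷ (Gc ++ boxes P₀)))
∷↭◇boxed⁻ p with ∷↭∷⁻ p
... | inj₁ r = inj₁ r
... | inj₂ (K , q₁ , q₂) with ∷↭boxed⁻ (↭-sym q₂)
...   | inj₁ (G₀ , r) = inj₂ (inj₁ (G₀ , ↭-trans q₁ (prep _ r)))
...   | inj₂ (ρ , σ , P₀ , e , q , r) = inj₂ (inj₂ (ρ , σ , P₀ , e , q , ↭-trans q₁ (prep _ r)))

∷∷↭boxed⁻ : ∀ {φ Γ Gc P} → φ ∷ φ ∷ Γ ↭ Gc ++ boxes P →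
            (∃ λ G₀ → φ ∷ Γ ↭ G₀ ++ boxes P) ⊎
            (∃ λ ρ → ∃ λ σ → ∃ λ P₁ → φ ≡ ρ □→ σ × P ↭ (ρ , σ) ∷ (ρ , σ) ∷ P₁ ×
               φ ∷ Γ ↭ Gc ++ boxes ((ρ , σ) ∷ P₁))
∷∷↭boxed⁻ {Gc = Gc} p with ∷↭boxed⁻ p
... | inj₁ r = inj₁ r
... | inj₂ (ρ , σ , P₀ , refl , q , r) with ∷↭boxed⁻ r
...   | inj₁ (G₁ , r′) =
  inj₁ (G₁ , ↭-trans (prep _ r′) (↭-trans (↭-sym (shift _ G₁ _)) (++⁺ˡ G₁ (boxes-↭ (↭-sym q)))))
...   | inj₂ (_ , _ , P₁ , refl , q′ , r′) =
  inj₂ (ρ , σ , P₁ , refl , ↭-trans q (prep _ q′) , ↭-trans r (++⁺ˡ Gc (boxes-↭ q′)))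

∷∷↭◇boxed⁻ : ∀ {φ Γ χ Gc P} → NotBox χ → φ ∷ φ ∷ Γ ↭ χ ∷ (Gc ++ boxes P) →
             (∃ λ G₀ → φ ∷ Γ ↭ χ ∷ (G₀ ++ boxes P)) ⊎
             (∃ λ ρ → ∃ λ σ → ∃ λ P₁ → φ ≡ ρ □→ σ × P ↭ (ρ , σ) ∷ (ρ , σ) ∷ P₁ ×
                φ ∷ Γ ↭ χ ∷ (Gc ++ boxes ((ρ , σ) ∷ P₁)))
∷∷↭◇boxed⁻ nb p with ∷↭◇boxed⁻ p
... | inj₁ (refl , q) with ∷↭boxed⁻ q
...   | inj₁ (G₀ , r) = inj₁ (G₀ , prep _ r)
...   | inj₂ (_ , _ , _ , e , _) = ⊥-elim (nb e)
∷∷↭◇boxed⁻ nb p | inj₂ (inj₁ r) = inj₁ r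
∷∷↭◇boxed⁻ {χ = χ} {Gc} nb p | inj₂ (inj₂ (ρ , σ , P₀ , refl , q , r)) with ∷↭∷⁻ r
... | inj₁ (refl , _) = ⊥-elim (nb refl)
... | inj₂ (K , r₁ , r₂) with ∷↭boxed⁻ (↭-sym r₂)
...   | inj₁ (G₁ , s) = inj₁ (G₁ , ↭-trans (prep _ r₁) (↭-trans (swap _ _ refl) (prep χ
          (↭-trans (prep _ s) (↭-trans (↭-sym (shift _ G₁ _)) (++⁺ˡ G₁ (boxes-↭ (↭-sym q))))))))
...   | inj₂ (_ , _ , P₁ , refl , q′ , s) = inj₂ (ρ , σ , P₁ , refl , ↭-trans q (prep _ q′) ,
          ↭-trans (prep _ r₁) (↭-trans (swap _ _ refl) (prep χ (↭-trans (prep _ s) (↭-sym (shift _ Gc _))))))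

nonBox∷↭boxed⁻ : ∀ {χ Γ Gc P} → NotBox χ → χ ∷ Γ ↭ Gc ++ boxes P → ∃ λ G₀ → Γ ↭ G₀ ++ boxes P
nonBox∷↭boxed⁻ nb p with ∷↭boxed⁻ p
... | inj₁ r = r
... | inj₂ (_ , _ , _ , e , _) = ⊥-elim (nb e)

nonBox∷↭◇boxed⁻ : ∀ {χ Γ ψ Gc P} → NotBox χ → (χ ≡ ψ → ⊥) → χ ∷ Γ ↭ ψ ∷ (Gc ++ boxes P) →
                  ∃ λ G₀ → Γ ↭ ψ ∷ (G₀ ++ boxes P)
nonBox∷↭◇boxed⁻ nb ne p with ∷↭◇boxed⁻ p
... | inj₁ (e , _) = ⊥-elim (ne e)
... | inj₂ (inj₁ r) = r
... | inj₂ (inj₂ (_ , _ , _ , e , _)) = ⊥-elim (nb e)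

++-boxed : ∀ (Γ : Ctx) {Γ′ G₀ B} → Γ′ ↭ G₀ ++ B → Γ ++ Γ′ ↭ (Γ ++ G₀) ++ B
++-boxed Γ {G₀ = G₀} {B} r = ↭-trans (++⁺ˡ Γ r) (↭-sym (++-assoc Γ G₀ B))

++-◇boxed : ∀ (Γ : Ctx) {Γ′ χ G₀ B} → Γ′ ↭ χ ∷ (G₀ ++ B) → Γ ++ Γ′ ↭ χ ∷ ((Γ ++ G₀) ++ B)
++-◇boxed Γ {G₀ = G₀} {B} r = ↭-trans (++-insert Γ r) (prep _ (↭-sym (++-assoc Γ G₀ B)))

boxed-++-boxed : ∀ {Γ Γ′ Gl Gc} P Q → Γ ↭ Gl ++ boxes P → Γ′ ↭ Gc ++ boxes Q →
                 Γ ++ Γ′ ↭ (Gl ++ Gc) ++ boxes (P ++ Q)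
boxed-++-boxed {Gl = Gl} {Gc} P Q p r =
  ↭-trans (++⁺ p r) (↭-trans (interchange Gl _ Gc _) (++⁺ˡ (Gl ++ Gc) (↭-reflexive (sym (map-++ _ P Q)))))

boxed-++-◇boxed : ∀ {Γ Γ′ Gl Gc χ} P Q → Γ ↭ Gl ++ boxes P → Γ′ ↭ χ ∷ (Gc ++ boxes Q) →
                  Γ ++ Γ′ ↭ χ ∷ ((Gl ++ Gc) ++ boxes (P ++ Q))
boxed-++-◇boxed {Gl = Gl} {Gc} {χ} P Q p r =
  ↭-trans (++⁺ʳ _ p) (↭-trans (++-insert (Gl ++ boxes P) r) (prep χ (boxed-++-boxed {Gl = Gl} {Gc} P Q ↭-refl ↭-refl)))

◇boxed-++-boxed : ∀ {Γ Γ′ Gl Gc χ} P Q → Γ ↭ χ ∷ (Gl ++ boxes P) → Γ′ ↭ Gc ++ boxes Q →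
                  Γ ++ Γ′ ↭ χ ∷ ((Gl ++ Gc) ++ boxes (P ++ Q))
◇boxed-++-boxed {Gl = Gl} {Gc} {χ} P Q p r =
  ↭-trans (++⁺ p r) (prep χ (boxed-++-boxed {Gl = Gl} {Gc} P Q ↭-refl ↭-refl))

plain⇒¬id : ∀ {S} → HasPlain S → HasId S → ⊥
plain⇒¬id plain-MP ()

module Structural (S : Calculus) where

  infix 4 ⊢[_]_⇒_ ⊢_⇒_

  ⊢[_]_⇒_ : ℕ → Ctx → Succ → Set
  ⊢[ h ] Γ ⇒ Δ = _⊢[_]_⇒_ S h Γ Δ

  ⊢_⇒_ : Ctx → Succ → Set
  ⊢ Γ ⇒ Δ = _⊢_⇒_ S Γ Δ

  ⊢-resp-↭ : ∀ {h Θ Θ′ Δ} → Θ ↭ Θ′ → ⊢[ h ] Θ ⇒ Δ → ⊢[ h ] Θ′ ⇒ Δ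
  ⊢-resp-↭ q (init p) = init (↭-sym-trans q p)
  ⊢-resp-↭ q (⊥L p) = ⊥L (↭-sym-trans q p)
  ⊢-resp-↭ q (∧L p d) = ∧L (↭-sym-trans q p) d
  ⊢-resp-↭ q (∧R d e) = ∧R (⊢-resp-↭ q d) (⊢-resp-↭ q e)
  ⊢-resp-↭ q (∨L p d e) = ∨L (↭-sym-trans q p) d e
  ⊢-resp-↭ q (∨R₁ d) = ∨R₁ (⊢-resp-↭ q d)
  ⊢-resp-↭ q (∨R₂ d) = ∨R₂ (⊢-resp-↭ q d)
  ⊢-resp-↭ q (⊃R d) = ⊃R (⊢-resp-↭ (prep _ q) d)
  ⊢-resp-↭ q (⊃L p d e) = ⊃L (↭-sym-trans q p) (⊢-resp-↭ q d) e
  ⊢-resp-↭ q (□R s p eq d) = □R s (↭-sym-trans q p) eq d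
  ⊢-resp-↭ q (◇R s p eq d₁ d₂ d₃) = ◇R s (↭-sym-trans q p) eq d₁ d₂ d₃
  ⊢-resp-↭ q (□◇ s p eq d) = □◇ s (↭-sym-trans q p) eq d
  ⊢-resp-↭ q (□Rid s p eq d) = □Rid s (↭-sym-trans q p) eq d
  ⊢-resp-↭ q (◇Rid s p eq d₁ d₂ d₃) = ◇Rid s (↭-sym-trans q p) eq d₁ d₂ d₃
  ⊢-resp-↭ q (□◇id s p eq d) = □◇id s (↭-sym-trans q p) eq d
  ⊢-resp-↭ q (mp□ s p d e) = mp□ s (↭-sym-trans q p) (⊢-resp-↭ q d) (⊢-resp-↭ (prep _ q) e)
  ⊢-resp-↭ q (mp◇ s d e) = mp◇ s (⊢-resp-↭ q d) (⊢-resp-↭ q e)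

  ⊢-mono : ∀ {h k Γ Δ} → h ≤ k → ⊢[ h ] Γ ⇒ Δ → ⊢[ k ] Γ ⇒ Δ
  Equivs-mono : ∀ {h k φ P} → h ≤ k → Equivs S h φ P → Equivs S k φ P
  ⊢-mono q (init p) = init p
  ⊢-mono q (⊥L p) = ⊥L p
  ⊢-mono (s≤s q) (∧L p d) = ∧L p (⊢-mono q d)
  ⊢-mono (s≤s q) (∧R d e) = ∧R (⊢-mono q d) (⊢-mono q e)
  ⊢-mono (s≤s q) (∨L p d e) = ∨L p (⊢-mono q d) (⊢-mono q e)
  ⊢-mono (s≤s q) (∨R₁ d) = ∨R₁ (⊢-mono q d)
  ⊢-mono (s≤s q) (∨R₂ d) = ∨R₂ (⊢-mono q d)
  ⊢-mono (s≤s q) (⊃R d) = ⊃R (⊢-mono q d)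
  ⊢-mono (s≤s q) (⊃L p d e) = ⊃L p (⊢-mono q d) (⊢-mono q e)
  ⊢-mono (s≤s q) (□R s p eq d) = □R s p (Equivs-mono q eq) (⊢-mono q d)
  ⊢-mono (s≤s q) (◇R s p eq d₁ d₂ d₃) = ◇R s p (Equivs-mono q eq) (⊢-mono q d₁) (⊢-mono q d₂) (⊢-mono q d₃)
  ⊢-mono (s≤s q) (□◇ s p eq d) = □◇ s p (Equivs-mono q eq) (⊢-mono q d)
  ⊢-mono (s≤s q) (□Rid s p eq d) = □Rid s p (Equivs-mono q eq) (⊢-mono q d)
  ⊢-mono (s≤s q) (◇Rid s p eq d₁ d₂ d₃) = ◇Rid s p (Equivs-mono q eq) (⊢-mono q d₁) (⊢-mono q d₂) (⊢-mono q d₃)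
  ⊢-mono (s≤s q) (□◇id s p eq d) = □◇id s p (Equivs-mono q eq) (⊢-mono q d)
  ⊢-mono (s≤s q) (mp□ s p d e) = mp□ s p (⊢-mono q d) (⊢-mono q e)
  ⊢-mono (s≤s q) (mp◇ s d e) = mp◇ s (⊢-mono q d) (⊢-mono q e)
  Equivs-mono q [] = []
  Equivs-mono q ((d , e) ∷ es) = (⊢-mono q d , ⊢-mono q e) ∷ Equivs-mono q es

  weakenL : ∀ {h Γ Δ} φ → ⊢[ h ] Γ ⇒ Δ → ⊢[ h ] φ ∷ Γ ⇒ Δ
  weakenL φ (init p) = init (∷-insert φ p)
  weakenL φ (⊥L p) = ⊥L (∷-insert φ p)
  weakenL φ (∧L p d) = ∧L (∷-insert φ p) (⊢-resp-↭ (shifts [ φ ] (_ ∷ _ ∷ [])) (weakenL φ d))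
  weakenL φ (∧R d e) = ∧R (weakenL φ d) (weakenL φ e)
  weakenL φ (∨L p d e) =
    ∨L (∷-insert φ p) (⊢-resp-↭ (swap φ _ refl) (weakenL φ d)) (⊢-resp-↭ (swap φ _ refl) (weakenL φ e))
  weakenL φ (∨R₁ d) = ∨R₁ (weakenL φ d)
  weakenL φ (∨R₂ d) = ∨R₂ (weakenL φ d)
  weakenL φ (⊃R d) = ⊃R (⊢-resp-↭ (swap φ _ refl) (weakenL φ d))
  weakenL φ (⊃L p d e) = ⊃L (∷-insert φ p) (weakenL φ d) (⊢-resp-↭ (swap φ _ refl) (weakenL φ e))
  weakenL φ (□R s p eq d) = □R {Γ = φ ∷ _} s (prep φ p) eq d
  weakenL φ (◇R s p eq d₁ d₂ d₃) = ◇R {Γ = φ ∷ _} s (∷-insert φ p) eq d₁ d₂ d₃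
  weakenL φ (□◇ s p eq d) = □◇ {Γ = φ ∷ _} s (∷-insert φ p) eq d
  weakenL φ (□Rid s p eq d) = □Rid {Γ = φ ∷ _} s (prep φ p) eq d
  weakenL φ (◇Rid s p eq d₁ d₂ d₃) = ◇Rid {Γ = φ ∷ _} s (∷-insert φ p) eq d₁ d₂ d₃
  weakenL φ (□◇id s p eq d) = □◇id {Γ = φ ∷ _} s (∷-insert φ p) eq d
  weakenL φ (mp□ s p d e) = mp□ s (∷-insert φ p) (weakenL φ d) (⊢-resp-↭ (swap φ _ refl) (weakenL φ e))
  weakenL φ (mp◇ s d e) = mp◇ s (weakenL φ d) (weakenL φ e)

  weakenLˡ : ∀ {h Γ Δ} Ξ → ⊢[ h ] Γ ⇒ Δ → ⊢[ h ] Ξ ++ Γ ⇒ Δ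
  weakenLˡ [] d = d
  weakenLˡ (φ ∷ Ξ) d = weakenL φ (weakenLˡ Ξ d)

  weakenR : ∀ {h Γ} φ → ⊢[ h ] Γ ⇒ nothing → ⊢[ h ] Γ ⇒ just φ
  weakenR φ (⊥L p) = ⊥L p
  weakenR φ (∧L p d) = ∧L p (weakenR φ d)
  weakenR φ (∨L p d e) = ∨L p (weakenR φ d) (weakenR φ e)
  weakenR φ (⊃L p d e) = ⊃L p d (weakenR φ e)
  weakenR φ (□◇ s p eq d) = □◇ s p eq d
  weakenR φ (□◇id s p eq d) = □◇id s p eq d
  weakenR φ (mp□ s p d e) = mp□ s p d (weakenR φ e)

  -- Inversion and contraction

  -- Inversion is proved once for every χ that can be principal only in ∧L, ∨L
  -- or ⊃L; the fields close that principal case.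
  record Invertible (χ : Fm) (χs : Ctx) : Set where
    field
      notBox : NotBox χ
      notVar : ∀ {n} → χ ≡ var n → ⊥
      not⊥ : χ ≡ ⊥' → ⊥
      not◇ : ∀ {a b} → χ ≡ a ◇→ b → ⊥
      from∧L : ∀ {h a b G Δ} → χ ≡ a ∧' b → ⊢[ h ] a ∷ b ∷ G ⇒ Δ → ⊢[ suc h ] χs ++ G ⇒ Δ
      from∨L : ∀ {h a b G Δ} → χ ≡ a ∨' b → ⊢[ h ] a ∷ G ⇒ Δ → ⊢[ h ] b ∷ G ⇒ Δ → ⊢[ suc h ] χs ++ G ⇒ Δ
      from⊃L : ∀ {h a b G Δ} → χ ≡ a ⊃ b → ⊢[ h ] b ∷ G ⇒ Δ → ⊢[ suc h ] χs ++ G ⇒ Δ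

  invert : ∀ {χ χs} → Invertible χ χs → ∀ {h Θ Γ Δ} → ⊢[ h ] Θ ⇒ Δ → Θ ↭ χ ∷ Γ → ⊢[ h ] χs ++ Γ ⇒ Δ
  invert I (init p) q with ∷↭∷⁻ (↭-sym-trans q p)
  ... | inj₁ (e , _) = ⊥-elim (Invertible.notVar I e)
  ... | inj₂ (K , r , _) = init (++-insert _ r)
  invert I (⊥L p) q with ∷↭∷⁻ (↭-sym-trans q p)
  ... | inj₁ (e , _) = ⊥-elim (Invertible.not⊥ I e)
  ... | inj₂ (K , r , _) = ⊥L (++-insert _ r)
  invert {χ} {χs} I (∧L {φ = a} {b} p d) q with ∷↭∷⁻ (↭-sym-trans q p)
  ... | inj₁ (e , r) = ⊢-resp-↭ (++⁺ˡ χs (↭-sym r)) (Invertible.from∧L I e d)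
  ... | inj₂ (K , r₁ , r₂) = ∧L (++-insert χs r₁) (⊢-resp-↭ (shifts χs (a ∷ b ∷ []))
          (invert I d (↭-trans (prep a (prep b r₂)) (↭-sym (shifts [ χ ] (a ∷ b ∷ []))))))
  invert I (∧R d e) q = ∧R (invert I d q) (invert I e q)
  invert {χ} {χs} I (∨L {φ = a} {b} p d e) q with ∷↭∷⁻ (↭-sym-trans q p)
  ... | inj₁ (e′ , r) = ⊢-resp-↭ (++⁺ˡ χs (↭-sym r)) (Invertible.from∨L I e′ d e)
  ... | inj₂ (K , r₁ , r₂) = ∨L (++-insert χs r₁)
          (⊢-resp-↭ (shift a χs K) (invert I d (↭-trans (prep a r₂) (swap a χ refl))))
          (⊢-resp-↭ (shift b χs K) (invert I e (↭-trans (prep b r₂) (swap b χ refl))))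
  invert I (∨R₁ d) q = ∨R₁ (invert I d q)
  invert I (∨R₂ d) q = ∨R₂ (invert I d q)
  invert {χ} {χs} I {Γ = Γ} (⊃R {φ = a} d) q =
    ⊃R (⊢-resp-↭ (shift a χs Γ) (invert I d (↭-trans (prep a q) (swap a χ refl))))
  invert {χ} {χs} I (⊃L {ψ = b} p d e) q with ∷↭∷⁻ (↭-sym-trans q p)
  ... | inj₁ (e′ , r) = ⊢-resp-↭ (++⁺ˡ χs (↭-sym r)) (Invertible.from⊃L I e′ e)
  ... | inj₂ (K , r₁ , r₂) = ⊃L (++-insert χs r₁) (invert I d q)
          (⊢-resp-↭ (shift b χs K) (invert I e (↭-trans (prep b r₂) (swap b χ refl))))
  invert {χs = χs} I (□R s p eq d) q with nonBox∷↭boxed⁻ (Invertible.notBox I) (↭-sym-trans q p)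
  ... | G₀ , r = □R {Γ = χs ++ G₀} s (++-boxed χs r) eq d
  invert {χs = χs} I (□Rid s p eq d) q with nonBox∷↭boxed⁻ (Invertible.notBox I) (↭-sym-trans q p)
  ... | G₀ , r = □Rid {Γ = χs ++ G₀} s (++-boxed χs r) eq d
  invert {χs = χs} I (◇R s p eq d₁ d₂ d₃) q
    with nonBox∷↭◇boxed⁻ (Invertible.notBox I) (Invertible.not◇ I) (↭-sym-trans q p)
  ... | G₀ , r = ◇R {Γ = χs ++ G₀} s (++-◇boxed χs r) eq d₁ d₂ d₃
  invert {χs = χs} I (◇Rid s p eq d₁ d₂ d₃) q
    with nonBox∷↭◇boxed⁻ (Invertible.notBox I) (Invertible.not◇ I) (↭-sym-trans q p)
  ... | G₀ , r = ◇Rid {Γ = χs ++ G₀} s (++-◇boxed χs r) eq d₁ d₂ d₃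
  invert {χs = χs} I (□◇ s p eq d) q
    with nonBox∷↭◇boxed⁻ (Invertible.notBox I) (Invertible.not◇ I) (↭-sym-trans q p)
  ... | G₀ , r = □◇ {Γ = χs ++ G₀} s (++-◇boxed χs r) eq d
  invert {χs = χs} I (□◇id s p eq d) q
    with nonBox∷↭◇boxed⁻ (Invertible.notBox I) (Invertible.not◇ I) (↭-sym-trans q p)
  ... | G₀ , r = □◇id {Γ = χs ++ G₀} s (++-◇boxed χs r) eq d
  invert {χ} {χs} I {Γ = Γ} (mp□ {ψ = b} s p d e) q with ∷↭∷⁻ (↭-sym-trans q p)
  ... | inj₁ (e′ , _) = ⊥-elim (Invertible.notBox I e′)
  ... | inj₂ (K , r , _) = mp□ s (++-insert χs r) (invert I d q)
          (⊢-resp-↭ (shift b χs Γ) (invert I e (↭-trans (prep b q) (swap b χ refl))))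
  invert I (mp◇ s d e) q = mp◇ s (invert I d q) (invert I e q)

  ∧L-inv : ∀ {h Θ Γ Δ a b} → ⊢[ h ] Θ ⇒ Δ → Θ ↭ (a ∧' b) ∷ Γ → ⊢[ h ] a ∷ b ∷ Γ ⇒ Δ
  ∧L-inv = invert record
    { notBox = λ () ; notVar = λ () ; not⊥ = λ () ; not◇ = λ ()
    ; from∧L = λ { refl d → ⊢-mono (n≤1+n _) d } ; from∨L = λ () ; from⊃L = λ () }

  ∨L-inv₁ : ∀ {h Θ Γ Δ a b} → ⊢[ h ] Θ ⇒ Δ → Θ ↭ (a ∨' b) ∷ Γ → ⊢[ h ] a ∷ Γ ⇒ Δ
  ∨L-inv₁ = invert record
    { notBox = λ () ; notVar = λ () ; not⊥ = λ () ; not◇ = λ ()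
    ; from∧L = λ () ; from∨L = λ { refl d _ → ⊢-mono (n≤1+n _) d } ; from⊃L = λ () }

  ∨L-inv₂ : ∀ {h Θ Γ Δ a b} → ⊢[ h ] Θ ⇒ Δ → Θ ↭ (a ∨' b) ∷ Γ → ⊢[ h ] b ∷ Γ ⇒ Δ
  ∨L-inv₂ = invert record
    { notBox = λ () ; notVar = λ () ; not⊥ = λ () ; not◇ = λ ()
    ; from∧L = λ () ; from∨L = λ { refl _ e → ⊢-mono (n≤1+n _) e } ; from⊃L = λ () }

  ⊃L-inv : ∀ {h Θ Γ Δ a b} → ⊢[ h ] Θ ⇒ Δ → Θ ↭ (a ⊃ b) ∷ Γ → ⊢[ h ] b ∷ Γ ⇒ Δ
  ⊃L-inv = invert record
    { notBox = λ () ; notVar = λ () ; not⊥ = λ () ; not◇ = λ ()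
    ; from∧L = λ () ; from∨L = λ () ; from⊃L = λ { refl e → ⊢-mono (n≤1+n _) e } }

  -- A duplicated box among the P of a conditional rule is absorbed by dropping
  -- one copy of its (repeated) equivalence premisses and contracting its consequent.
  Equivs-dropDuplicate : ∀ {h φ P ρ σ P₁} → P ↭ (ρ , σ) ∷ (ρ , σ) ∷ P₁ →
                         Equivs S h φ P → Equivs S h φ ((ρ , σ) ∷ P₁)
  Equivs-dropDuplicate q eq with All-resp-↭ q eq
  ... | _ ∷ rest = rest

  contract↭ : ∀ h {Θ φ Γ Δ} → ⊢[ h ] Θ ⇒ Δ → Θ ↭ φ ∷ φ ∷ Γ → ⊢[ h ] φ ∷ Γ ⇒ Δ
  contract↭ h (init p) q with ∷∷↭∷⇒∷↭∷ (↭-sym-trans q p)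
  ... | _ , r = init r
  contract↭ h (⊥L p) q with ∷∷↭∷⇒∷↭∷ (↭-sym-trans q p)
  ... | _ , r = ⊥L r
  contract↭ (suc h) {φ = φ} {Γ} (∧L {φ = a} {b} p d) q with ∷∷↭∷⁻ (↭-sym-trans q p)
  ... | inj₁ (refl , r) =
    ∧L ↭-refl (⊢-resp-↭ (swap b a refl) (contract↭ h
      (contract↭ h (∧L-inv d (↭-trans (prep a (prep b r)) (↭-sym (shifts [ φ ] (a ∷ b ∷ [])))))
        (prep a (swap b a refl)))
      (shifts [ a ] (b ∷ b ∷ []))))
  ... | inj₂ (K , r₁ , r₂) =
    ∧L (∷-insert φ r₁) (⊢-resp-↭ (shifts [ φ ] (a ∷ b ∷ [])) (contract↭ h d
      (↭-trans (prep a (prep b r₂)) (shifts (a ∷ b ∷ []) (φ ∷ φ ∷ [])))))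
  contract↭ (suc h) (∧R d e) q = ∧R (contract↭ h d q) (contract↭ h e q)
  contract↭ (suc h) {φ = φ} (∨L {φ = a} {b} p d e) q with ∷∷↭∷⁻ (↭-sym-trans q p)
  ... | inj₁ (refl , r) =
    ∨L ↭-refl (contract↭ h (∨L-inv₁ d (↭-trans (prep a r) (swap a _ refl))) ↭-refl)
              (contract↭ h (∨L-inv₂ e (↭-trans (prep b r) (swap b _ refl))) ↭-refl)
  ... | inj₂ (K , r₁ , r₂) =
    ∨L (∷-insert φ r₁)
      (⊢-resp-↭ (swap φ a refl) (contract↭ h d (↭-trans (prep a r₂) (shifts [ a ] (φ ∷ φ ∷ [])))))
      (⊢-resp-↭ (swap φ b refl) (contract↭ h e (↭-trans (prep b r₂) (shifts [ b ] (φ ∷ φ ∷ [])))))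
  contract↭ (suc h) (∨R₁ d) q = ∨R₁ (contract↭ h d q)
  contract↭ (suc h) (∨R₂ d) q = ∨R₂ (contract↭ h d q)
  contract↭ (suc h) {φ = φ} (⊃R {φ = a} d) q =
    ⊃R (⊢-resp-↭ (swap φ a refl) (contract↭ h d (↭-trans (prep a q) (shifts [ a ] (φ ∷ φ ∷ [])))))
  contract↭ (suc h) {φ = φ} (⊃L {ψ = b} p d e) q with ∷∷↭∷⁻ (↭-sym-trans q p)
  ... | inj₁ (refl , r) =
    ⊃L ↭-refl (contract↭ h d q) (contract↭ h (⊃L-inv e (↭-trans (prep b r) (swap b _ refl))) ↭-refl)
  ... | inj₂ (K , r₁ , r₂) =
    ⊃L (∷-insert φ r₁) (contract↭ h d q)
      (⊢-resp-↭ (swap φ b refl) (contract↭ h e (↭-trans (prep b r₂) (shifts [ b ] (φ ∷ φ ∷ [])))))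
  contract↭ (suc h) (□R s p eq d) q with ∷∷↭boxed⁻ (↭-sym-trans q p)
  ... | inj₁ (_ , r) = □R s r eq d
  ... | inj₂ (_ , _ , _ , refl , qP , r) =
    □R s r (Equivs-dropDuplicate qP eq) (contract↭ h d (conseqs-↭ qP))
  contract↭ (suc h) (□Rid {φ = a} s p eq d) q with ∷∷↭boxed⁻ (↭-sym-trans q p)
  ... | inj₁ (_ , r) = □Rid s r eq d
  ... | inj₂ (_ , σ , _ , refl , qP , r) = □Rid s r (Equivs-dropDuplicate qP eq)
          (⊢-resp-↭ (swap σ a refl)
            (contract↭ h d (↭-trans (prep a (conseqs-↭ qP)) (shifts [ a ] (σ ∷ σ ∷ [])))))
  contract↭ (suc h) (◇R {ψ = b} s p eq d₁ d₂ d₃) q with ∷∷↭◇boxed⁻ (λ ()) (↭-sym-trans q p)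
  ... | inj₁ (_ , r) = ◇R s r eq d₁ d₂ d₃
  ... | inj₂ (_ , σ , _ , refl , qP , r) = ◇R s r (Equivs-dropDuplicate qP eq) d₁ d₂
          (⊢-resp-↭ (swap σ b refl)
            (contract↭ h d₃ (↭-trans (prep b (conseqs-↭ qP)) (shifts [ b ] (σ ∷ σ ∷ [])))))
  contract↭ (suc h) (□◇ {ψ = b} s p eq d) q with ∷∷↭◇boxed⁻ (λ ()) (↭-sym-trans q p)
  ... | inj₁ (_ , r) = □◇ s r eq d
  ... | inj₂ (_ , σ , _ , refl , qP , r) = □◇ s r (Equivs-dropDuplicate qP eq)
          (⊢-resp-↭ (swap σ b refl)
            (contract↭ h d (↭-trans (prep b (conseqs-↭ qP)) (shifts [ b ] (σ ∷ σ ∷ [])))))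
  contract↭ (suc h) (◇Rid {φ = a} {b} s p eq d₁ d₂ d₃) q with ∷∷↭◇boxed⁻ (λ ()) (↭-sym-trans q p)
  ... | inj₁ (_ , r) = ◇Rid s r eq d₁ d₂ d₃
  ... | inj₂ (_ , σ , _ , refl , qP , r) = ◇Rid s r (Equivs-dropDuplicate qP eq) d₁ d₂
          (⊢-resp-↭ (shifts [ σ ] (a ∷ b ∷ [])) (contract↭ h d₃
            (↭-trans (prep a (prep b (conseqs-↭ qP))) (shifts (a ∷ b ∷ []) (σ ∷ σ ∷ [])))))
  contract↭ (suc h) (□◇id {φ = a} {b} s p eq d) q with ∷∷↭◇boxed⁻ (λ ()) (↭-sym-trans q p)
  ... | inj₁ (_ , r) = □◇id s r eq d
  ... | inj₂ (_ , σ , _ , refl , qP , r) = □◇id s r (Equivs-dropDuplicate qP eq)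
          (⊢-resp-↭ (shifts [ σ ] (a ∷ b ∷ [])) (contract↭ h d
            (↭-trans (prep a (prep b (conseqs-↭ qP))) (shifts (a ∷ b ∷ []) (σ ∷ σ ∷ [])))))
  contract↭ (suc h) {φ = φ} (mp□ {ψ = b} s p d e) q with ∷∷↭∷⇒∷↭∷ (↭-sym-trans q p)
  ... | _ , r = mp□ s r (contract↭ h d q)
          (⊢-resp-↭ (swap φ b refl) (contract↭ h e (↭-trans (prep b q) (shifts [ b ] (φ ∷ φ ∷ [])))))
  contract↭ (suc h) (mp◇ s d e) q = mp◇ s (contract↭ h d q) (contract↭ h e q)

  contract : ∀ {h φ Γ Δ} → ⊢[ h ] φ ∷ φ ∷ Γ ⇒ Δ → ⊢[ h ] φ ∷ Γ ⇒ Δ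
  contract {h} d = contract↭ h d ↭-refl

  contract-++ : ∀ {h Γ Δ} Ξ → ⊢[ h ] Ξ ++ Ξ ++ Γ ⇒ Δ → ⊢[ h ] Ξ ++ Γ ⇒ Δ
  contract-++ [] d = d
  contract-++ {Γ = Γ} (φ ∷ Ξ) d =
    ⊢-resp-↭ (shift φ Ξ Γ) (contract-++ {Γ = φ ∷ Γ} Ξ
      (⊢-resp-↭ (↭-trans (↭-sym (shift φ Ξ (Ξ ++ Γ))) (++⁺ˡ Ξ (↭-sym (shift φ Ξ Γ))))
        (contract (⊢-resp-↭ (prep φ (shift φ Ξ (Ξ ++ Γ))) d))))

  -- Derivability without a height bound

  ⊢′-resp-↭ : ∀ {Θ Θ′ Δ} → Θ ↭ Θ′ → ⊢ Θ ⇒ Δ → ⊢ Θ′ ⇒ Δ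
  ⊢′-resp-↭ q (h , d) = h , ⊢-resp-↭ q d

  weakenLˡ′ : ∀ {Γ Δ} Ξ → ⊢ Γ ⇒ Δ → ⊢ Ξ ++ Γ ⇒ Δ
  weakenLˡ′ Ξ (h , d) = h , weakenLˡ Ξ d

  weakenLʳ′ : ∀ {Γ Δ} Ξ → ⊢ Γ ⇒ Δ → ⊢ Γ ++ Ξ ⇒ Δ
  weakenLʳ′ {Γ} Ξ d = ⊢′-resp-↭ (++-comm Ξ Γ) (weakenLˡ′ Ξ d)

  weakenR-any′ : ∀ {Γ} Δ → ⊢ Γ ⇒ nothing → ⊢ Γ ⇒ Δ
  weakenR-any′ nothing d = d
  weakenR-any′ (just φ) (h , d) = h , weakenR φ d

  contract′ : ∀ {φ Γ Δ} → ⊢ φ ∷ φ ∷ Γ ⇒ Δ → ⊢ φ ∷ Γ ⇒ Δ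
  contract′ (h , d) = h , contract d

  contract-++′ : ∀ {Γ Δ} Ξ → ⊢ Ξ ++ Ξ ++ Γ ⇒ Δ → ⊢ Ξ ++ Γ ⇒ Δ
  contract-++′ Ξ (h , d) = h , contract-++ Ξ d

  contract-double′ : ∀ {Δ} Ξ → ⊢ Ξ ++ Ξ ⇒ Δ → ⊢ Ξ ⇒ Δ
  contract-double′ Ξ d =
    ⊢′-resp-↭ (++-identityʳ Ξ) (contract-++′ {Γ = []} Ξ (⊢′-resp-↭ (↭-sym (++⁺ˡ Ξ (++-identityʳ Ξ))) d))

  Equivs′ : Fm → List (Fm × Fm) → Set
  Equivs′ φ P = All (λ p → ⊢ [ φ ] ⇒ just (proj₁ p) × ⊢ [ proj₁ p ] ⇒ just φ) P

  Equivs⇒Equivs′ : ∀ {h φ P} → Equivs S h φ P → Equivs′ φ P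
  Equivs⇒Equivs′ = All.map λ (d , e) → (_ , d) , (_ , e)

  eventually : ∀ {Γ Δ} → ⊢ Γ ⇒ Δ → Eventually (λ k → ⊢[ k ] Γ ⇒ Δ)
  eventually (h , d) = h , λ q → ⊢-mono q d

  eventuallyEquivs : ∀ {φ P} → Equivs′ φ P → Eventually (λ k → Equivs S k φ P)
  eventuallyEquivs [] = 0 , λ _ → []
  eventuallyEquivs ((d , e) ∷ es) =
    Eventually-map (λ (d , e , es) → (d , e) ∷ es) (eventually d ⊗ eventually e ⊗ eventuallyEquivs es)

  -- Rules are applied to height-free premisses by lifting them to a common height.
  by : ∀ {F Γ Δ} → Eventually F → (∀ {k} → F k → ⊢[ suc k ] Γ ⇒ Δ) → ⊢ Γ ⇒ Δ
  by (h , f) rule = suc h , rule (f ≤-refl)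

  ∧L′ : ∀ {Θ G Δ a b} → Θ ↭ (a ∧' b) ∷ G → ⊢ a ∷ b ∷ G ⇒ Δ → ⊢ Θ ⇒ Δ
  ∧L′ p d = by (eventually d) (∧L p)

  ∨L′ : ∀ {Θ G Δ a b} → Θ ↭ (a ∨' b) ∷ G → ⊢ a ∷ G ⇒ Δ → ⊢ b ∷ G ⇒ Δ → ⊢ Θ ⇒ Δ
  ∨L′ p d e = by (eventually d ⊗ eventually e) λ (d , e) → ∨L p d e

  ⊃L′ : ∀ {Θ G Δ a b} → Θ ↭ (a ⊃ b) ∷ G → ⊢ Θ ⇒ just a → ⊢ b ∷ G ⇒ Δ → ⊢ Θ ⇒ Δ
  ⊃L′ p d e = by (eventually d ⊗ eventually e) λ (d , e) → ⊃L p d e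

  ∧R′ : ∀ {Θ a b} → ⊢ Θ ⇒ just a → ⊢ Θ ⇒ just b → ⊢ Θ ⇒ just (a ∧' b)
  ∧R′ d e = by (eventually d ⊗ eventually e) λ (d , e) → ∧R d e

  ∨R₁′ : ∀ {Θ a b} → ⊢ Θ ⇒ just a → ⊢ Θ ⇒ just (a ∨' b)
  ∨R₁′ d = by (eventually d) ∨R₁

  ∨R₂′ : ∀ {Θ a b} → ⊢ Θ ⇒ just b → ⊢ Θ ⇒ just (a ∨' b)
  ∨R₂′ d = by (eventually d) ∨R₂

  ⊃R′ : ∀ {Θ a b} → ⊢ a ∷ Θ ⇒ just b → ⊢ Θ ⇒ just (a ⊃ b)
  ⊃R′ d = by (eventually d) ⊃R

  mp□′ : ∀ {Θ G Δ a b} → HasMP S → Θ ↭ (a □→ b) ∷ G → ⊢ Θ ⇒ just a → ⊢ b ∷ Θ ⇒ Δ → ⊢ Θ ⇒ Δ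
  mp□′ s p d e = by (eventually d ⊗ eventually e) λ (d , e) → mp□ s p d e

  mp◇′ : ∀ {Θ a b} → HasMP S → ⊢ Θ ⇒ just a → ⊢ Θ ⇒ just b → ⊢ Θ ⇒ just (a ◇→ b)
  mp◇′ s d e = by (eventually d ⊗ eventually e) λ (d , e) → mp◇ s d e

  □R′ : ∀ {Θ G P φ ψ} → HasPlain S → Θ ↭ G ++ boxes P → Equivs′ φ P → ⊢ conseqs P ⇒ just ψ →
        ⊢ Θ ⇒ just (φ □→ ψ)
  □R′ s p eq d = by (eventuallyEquivs eq ⊗ eventually d) λ (eq , d) → □R s p eq d

  □Rid′ : ∀ {Θ G P φ ψ} → HasId S → Θ ↭ G ++ boxes P → Equivs′ φ P → ⊢ φ ∷ conseqs P ⇒ just ψ →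
          ⊢ Θ ⇒ just (φ □→ ψ)
  □Rid′ s p eq d = by (eventuallyEquivs eq ⊗ eventually d) λ (eq , d) → □Rid s p eq d

  ◇R′ : ∀ {Θ G P φ ψ η ϑ} → HasPlain S → Θ ↭ (φ ◇→ ψ) ∷ (G ++ boxes P) → Equivs′ φ P →
        ⊢ [ φ ] ⇒ just η → ⊢ [ η ] ⇒ just φ → ⊢ ψ ∷ conseqs P ⇒ just ϑ → ⊢ Θ ⇒ just (η ◇→ ϑ)
  ◇R′ s p eq d₁ d₂ d₃ = by (eventuallyEquivs eq ⊗ eventually d₁ ⊗ eventually d₂ ⊗ eventually d₃)
    λ (eq , d₁ , d₂ , d₃) → ◇R s p eq d₁ d₂ d₃

  ◇Rid′ : ∀ {Θ G P φ ψ η ϑ} → HasId S → Θ ↭ (φ ◇→ ψ) ∷ (G ++ boxes P) → Equivs′ φ P →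
          ⊢ [ φ ] ⇒ just η → ⊢ [ η ] ⇒ just φ → ⊢ φ ∷ ψ ∷ conseqs P ⇒ just ϑ → ⊢ Θ ⇒ just (η ◇→ ϑ)
  ◇Rid′ s p eq d₁ d₂ d₃ = by (eventuallyEquivs eq ⊗ eventually d₁ ⊗ eventually d₂ ⊗ eventually d₃)
    λ (eq , d₁ , d₂ , d₃) → ◇Rid s p eq d₁ d₂ d₃

  □◇′ : ∀ {Θ G P φ ψ Δ} → HasPlain S → Θ ↭ (φ ◇→ ψ) ∷ (G ++ boxes P) → Equivs′ φ P →
        ⊢ ψ ∷ conseqs P ⇒ nothing → ⊢ Θ ⇒ Δ
  □◇′ s p eq d = by (eventuallyEquivs eq ⊗ eventually d) λ (eq , d) → □◇ s p eq d

  □◇id′ : ∀ {Θ G P φ ψ Δ} → HasId S → Θ ↭ (φ ◇→ ψ) ∷ (G ++ boxes P) → Equivs′ φ P →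
          ⊢ φ ∷ ψ ∷ conseqs P ⇒ nothing → ⊢ Θ ⇒ Δ
  □◇id′ s p eq d = by (eventuallyEquivs eq ⊗ eventually d) λ (eq , d) → □◇id s p eq d

  mp□-all : HasMP S → ∀ P {Θ G Δ} → Θ ↭ G ++ boxes P → All (λ p → ⊢ Θ ⇒ just (proj₁ p)) P →
            ⊢ conseqs P ++ Θ ⇒ Δ → ⊢ Θ ⇒ Δ
  mp□-all s [] q ds d = d
  mp□-all s ((ρ , σ) ∷ P) {Θ} {G} q (dρ ∷ ds) d =
    mp□-all s P {Θ} {G ++ [ ρ □→ σ ]} (↭-trans q (↭-sym (++-assoc G [ ρ □→ σ ] (boxes P)))) ds
      (mp□′ s (↭-trans (++⁺ˡ (conseqs P) (↭-trans q (shift _ G (boxes P)))) (shift _ (conseqs P) _))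
        (weakenLˡ′ (conseqs P) dρ) d)

  -- Cut

  Cut : Fm → Set
  Cut φ = ∀ {Γ Γ′ Δ} → ⊢ Γ ⇒ just φ → ⊢ φ ∷ Γ′ ⇒ Δ → ⊢ Γ ++ Γ′ ⇒ Δ

  CutBelow : Fm → Set
  CutBelow (var _) = ⊤
  CutBelow ⊥' = ⊤
  CutBelow (a ∧' b) = Cut a × Cut b
  CutBelow (a ∨' b) = Cut a × Cut b
  CutBelow (a ⊃ b) = Cut a × Cut b
  CutBelow (a □→ b) = Cut a × Cut b
  CutBelow (a ◇→ b) = Cut a × Cut b

  data RightIntro (Γ : Ctx) : Fm → Set where
    by∧R : ∀ {a b} → ⊢ Γ ⇒ just a → ⊢ Γ ⇒ just b → RightIntro Γ (a ∧' b)
    by∨R₁ : ∀ {a b} → ⊢ Γ ⇒ just a → RightIntro Γ (a ∨' b)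
    by∨R₂ : ∀ {a b} → ⊢ Γ ⇒ just b → RightIntro Γ (a ∨' b)
    by⊃R : ∀ {a b} → ⊢ a ∷ Γ ⇒ just b → RightIntro Γ (a ⊃ b)
    by□R : ∀ {G P a b} → HasPlain S → Γ ↭ G ++ boxes P → Equivs′ a P → ⊢ conseqs P ⇒ just b →
           RightIntro Γ (a □→ b)
    by□Rid : ∀ {G P a b} → HasId S → Γ ↭ G ++ boxes P → Equivs′ a P → ⊢ a ∷ conseqs P ⇒ just b →
             RightIntro Γ (a □→ b)
    by◇R : ∀ {G P a b η ϑ} → HasPlain S → Γ ↭ (a ◇→ b) ∷ (G ++ boxes P) → Equivs′ a P →
           ⊢ [ a ] ⇒ just η → ⊢ [ η ] ⇒ just a → ⊢ b ∷ conseqs P ⇒ just ϑ → RightIntro Γ (η ◇→ ϑ)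
    by◇Rid : ∀ {G P a b η ϑ} → HasId S → Γ ↭ (a ◇→ b) ∷ (G ++ boxes P) → Equivs′ a P →
             ⊢ [ a ] ⇒ just η → ⊢ [ η ] ⇒ just a → ⊢ a ∷ b ∷ conseqs P ⇒ just ϑ → RightIntro Γ (η ◇→ ϑ)
    bymp◇ : ∀ {a b} → HasMP S → ⊢ Γ ⇒ just a → ⊢ Γ ⇒ just b → RightIntro Γ (a ◇→ b)

  Equivs′-trans : ∀ {A C P} → Cut A → ⊢ [ C ] ⇒ just A → ⊢ [ A ] ⇒ just C → Equivs′ A P → Equivs′ C P
  Equivs′-trans cA dCA dAC = All.map λ (dAρ , dρA) → cA dCA dAρ , cA dρA dAC

  Equivs-uncons↭ : ∀ {h C P A B P₀} → P ↭ (A , B) ∷ P₀ → Equivs S h C P →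
                   (⊢[ h ] [ C ] ⇒ just A × ⊢[ h ] [ A ] ⇒ just C) × Equivs S h C P₀
  Equivs-uncons↭ q eq with All-resp-↭ q eq
  ... | x ∷ rest = x , rest

  -- Merging A □→ B (introduced with premisses A ⇔ P) into a rule whose P′
  -- contains it: C ⇔ A and A ⇔ ρ give C ⇔ ρ by a cut on A.
  Equivs-merge : ∀ {h A B C P P′ P₀} → Cut A → P′ ↭ (A , B) ∷ P₀ → Equivs S h C P′ → Equivs′ A P →
                 Equivs′ C (P ++ P₀)
  Equivs-merge cA q eq eA with Equivs-uncons↭ q eq
  ... | (dCA , dAC) , e₀ = All.++⁺ (Equivs′-trans cA (_ , dCA) (_ , dAC) eA) (Equivs⇒Equivs′ e₀)

  conseqs-merge : ∀ {h A B P P′ P₀ Δ} → Cut B → ⊢ conseqs P ⇒ just B → (Ys : Ctx) →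
                  ⊢[ h ] Ys ++ conseqs P′ ⇒ Δ → P′ ↭ (A , B) ∷ P₀ → ⊢ Ys ++ conseqs (P ++ P₀) ⇒ Δ
  conseqs-merge {h} {B = B} {P} {P₀ = P₀} {Δ} cB dB Ys d q =
    subst (λ L → ⊢ Ys ++ L ⇒ Δ) (sym (map-++ _ P P₀))
      (⊢′-resp-↭ (shifts (conseqs P) Ys)
        (cB dB (h , ⊢-resp-↭ (↭-trans (++⁺ˡ Ys (conseqs-↭ q)) (shift B Ys _)) d)))

  conseqs-mergeId : ∀ {h A B C P P′ P₀ Δ} → Cut A → Cut B → P′ ↭ (A , B) ∷ P₀ → Equivs S h C P′ →
                    ⊢ A ∷ conseqs P ⇒ just B → (Ys : Ctx) → ⊢[ h ] C ∷ Ys ++ conseqs P′ ⇒ Δ →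
                    ⊢ C ∷ Ys ++ conseqs (P ++ P₀) ⇒ Δ
  conseqs-mergeId {h} {A} {B} {C} {P} {P₀ = P₀} {Δ} cA cB q eq dB Ys d with Equivs-uncons↭ q eq
  ... | (dCA , _) , _ =
    subst (λ L → ⊢ C ∷ Ys ++ L ⇒ Δ) (sym (map-++ _ P P₀))
      (contract′ (cA (h , dCA) (⊢′-resp-↭ (prep A (shifts (conseqs P) (C ∷ Ys)))
        (cB dB (h , ⊢-resp-↭ (↭-trans (prep C (++⁺ˡ Ys (conseqs-↭ q))) (shift B (C ∷ Ys) _)) d)))))

  antecedents : ∀ {Θ a P} → Cut a → ⊢ Θ ⇒ just a → Equivs′ a P → All (λ p → ⊢ Θ ⇒ just (proj₁ p)) P
  antecedents ca dA = All.map λ (daρ , _) → ⊢′-resp-↭ (++-identityʳ _) (ca dA daρ)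

  -- With mp□ the boxes of P′ in Γ′ can be fired once their antecedents, which
  -- are equivalent to C, are derived from Γ ⇒ C.
  mp□-fire : ∀ {h Γ Γ′ G P C Δ} → HasMP S → Cut C → ⊢ Γ ⇒ just C → Γ′ ↭ G ++ boxes P →
             Equivs S h C P → ⊢ Γ ++ conseqs P ⇒ Δ → ⊢ Γ ++ Γ′ ⇒ Δ
  mp□-fire {Γ = Γ} {Γ′} {G} {P} s cC dC r eq d =
    mp□-all s P {Γ ++ Γ′} {Γ ++ G} (++-boxed Γ r) (antecedents cC (weakenLʳ′ Γ′ dC) (Equivs⇒Equivs′ eq))
      (⊢′-resp-↭ (↭-trans (++-assoc Γ _ Γ′) (shifts Γ (conseqs P))) (weakenLʳ′ Γ′ d))

  cut-∧ : ∀ {h Γ Γ′ G Δ a b} → Cut a → Cut b → RightIntro Γ (a ∧' b) → ⊢[ h ] a ∷ b ∷ G ⇒ Δ → Γ′ ↭ G →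
          ⊢ Γ ++ Γ′ ⇒ Δ
  cut-∧ {h} {Γ} {G = G} {a = a} {b} ca cb (by∧R da db) d r =
    ⊢′-resp-↭ (++⁺ˡ Γ (↭-sym r))
      (contract-++′ Γ (ca da (⊢′-resp-↭ (shift a Γ G) (cb db (h , ⊢-resp-↭ (swap a b refl) d)))))

  cut-∨ : ∀ {h Γ Γ′ G Δ a b} → Cut a → Cut b → RightIntro Γ (a ∨' b) →
          ⊢[ h ] a ∷ G ⇒ Δ → ⊢[ h ] b ∷ G ⇒ Δ → Γ′ ↭ G → ⊢ Γ ++ Γ′ ⇒ Δ
  cut-∨ {h} {Γ} ca cb (by∨R₁ da) d e r = ⊢′-resp-↭ (++⁺ˡ Γ (↭-sym r)) (ca da (h , d))
  cut-∨ {h} {Γ} ca cb (by∨R₂ db) d e r = ⊢′-resp-↭ (++⁺ˡ Γ (↭-sym r)) (cb db (h , e))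

  cut-⊃ : ∀ {h Γ Γ′ G Δ a b} → Cut a → Cut b → RightIntro Γ (a ⊃ b) → ⊢ Γ ++ Γ′ ⇒ just a →
          ⊢[ h ] b ∷ G ⇒ Δ → Γ′ ↭ G → ⊢ Γ ++ Γ′ ⇒ Δ
  cut-⊃ {h} {Γ} {Γ′} ca cb (by⊃R dab) dA e r =
    contract-double′ (Γ ++ Γ′) (⊢′-resp-↭ (↭-trans (++⁺ˡ ((Γ ++ Γ′) ++ Γ) (↭-sym r)) (++-assoc (Γ ++ Γ′) Γ Γ′))
      (cb (ca dA dab) (h , e)))

  -- mp□ on a □-introduced A □→ B: fire the boxes of its P instead, then cut on B.
  cut-mp□ : ∀ {Γ Γ′ Δ a b} → HasMP S → Cut a → Cut b → RightIntro Γ (a □→ b) → ⊢ Γ ++ Γ′ ⇒ just a →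
            ⊢ b ∷ Γ ++ Γ′ ⇒ Δ → ⊢ Γ ++ Γ′ ⇒ Δ
  cut-mp□ {Γ} {Γ′} s ca cb (by□R {G} {P} _ p eA dB) dA dD =
    contract-double′ (Γ ++ Γ′) (cb (mp□-all s P {Γ ++ Γ′} {G ++ Γ′} (↭-trans (++⁺ʳ Γ′ p) (xy∙z≈xz∙y G _ Γ′))
      (antecedents ca dA eA) (weakenLʳ′ (Γ ++ Γ′) dB)) dD)
  cut-mp□ {Γ} {Γ′} s ca cb (by□Rid {G} {P} _ p eA dB) dA dD =
    contract-double′ (Γ ++ Γ′) (cb (mp□-all s P {Γ ++ Γ′} {G ++ Γ′} (↭-trans (++⁺ʳ Γ′ p) (xy∙z≈xz∙y G _ Γ′))
      (antecedents ca dA eA) (⊢′-resp-↭ (++-comm (Γ ++ Γ′) _) (ca dA dB))) dD)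

  cut-◇R : ∀ {h Γ Γ′ G P′ C D ζ θ} → HasPlain S → Cut C → Cut D → RightIntro Γ (C ◇→ D) →
           Γ′ ↭ G ++ boxes P′ → Equivs S h C P′ → ⊢[ h ] [ C ] ⇒ just ζ → ⊢[ h ] [ ζ ] ⇒ just C →
           ⊢[ h ] D ∷ conseqs P′ ⇒ just θ → ⊢ Γ ++ Γ′ ⇒ just (ζ ◇→ θ)
  cut-◇R {h} {P′ = P′} _ cC cD (by◇R {P = P} {b = b} s p eA daC dCa dL) r eq dCζ dζC dR =
    ◇R′ s (◇boxed-++-boxed P P′ p r) (All.++⁺ eA (Equivs′-trans cC daC dCa (Equivs⇒Equivs′ eq)))
      (cC daC (h , dCζ)) (cC (h , dζC) dCa)
      (subst (λ L → ⊢ b ∷ L ⇒ _) (sym (map-++ _ P P′)) (cD dL (h , dR)))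
  cut-◇R s _ _ (by◇Rid s′ _ _ _ _ _) _ _ _ _ _ = ⊥-elim (plain⇒¬id s s′)
  cut-◇R {h} {Γ} {Γ′} _ cC cD (bymp◇ m dC dD) r eq dCζ dζC dR =
    mp◇′ m (weakenLʳ′ Γ′ (⊢′-resp-↭ (++-identityʳ Γ) (cC dC (h , dCζ))))
      (mp□-fire m cC dC r eq (cD dD (h , dR)))

  cut-◇Rid : ∀ {h Γ Γ′ G P′ C D ζ θ} → HasId S → Cut C → Cut D → RightIntro Γ (C ◇→ D) →
             Γ′ ↭ G ++ boxes P′ → Equivs S h C P′ → ⊢[ h ] [ C ] ⇒ just ζ → ⊢[ h ] [ ζ ] ⇒ just C →
             ⊢[ h ] C ∷ D ∷ conseqs P′ ⇒ just θ → ⊢ Γ ++ Γ′ ⇒ just (ζ ◇→ θ)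
  cut-◇Rid {h} {P′ = P′} {C} {D} _ cC cD (by◇Rid {P = P} {a} {b} s p eA daC dCa dL) r eq dCζ dζC dR =
    ◇Rid′ s (◇boxed-++-boxed P P′ p r) (All.++⁺ eA (Equivs′-trans cC daC dCa (Equivs⇒Equivs′ eq)))
      (cC daC (h , dCζ)) (cC (h , dζC) dCa)
      (subst (λ L → ⊢ a ∷ b ∷ L ⇒ _) (sym (map-++ _ P P′))
        (contract′ (cC daC (⊢′-resp-↭ (shift C (a ∷ b ∷ conseqs P) (conseqs P′))
          (cD dL (h , ⊢-resp-↭ (swap C D refl) dR))))))
  cut-◇Rid s _ _ (by◇R s′ _ _ _ _ _) _ _ _ _ _ = ⊥-elim (plain⇒¬id s′ s)
  cut-◇Rid {h} {Γ} {Γ′} {P′ = P′} {C} {D} _ cC cD (bymp◇ m dC dD) r eq dCζ dζC dR =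
    mp◇′ m (weakenLʳ′ Γ′ (⊢′-resp-↭ (++-identityʳ Γ) (cC dC (h , dCζ))))
      (mp□-fire m cC dC r eq (contract-++′ Γ (cC dC (⊢′-resp-↭ (shift C Γ (conseqs P′))
        (cD dD (h , ⊢-resp-↭ (swap C D refl) dR))))))

  cut-□◇ : ∀ {h Γ Γ′ G P′ C D Δ} → HasPlain S → Cut C → Cut D → RightIntro Γ (C ◇→ D) →
           Γ′ ↭ G ++ boxes P′ → Equivs S h C P′ → ⊢[ h ] D ∷ conseqs P′ ⇒ nothing → ⊢ Γ ++ Γ′ ⇒ Δ
  cut-□◇ {h} {P′ = P′} _ cC cD (by◇R {P = P} {b = b} s p eA daC dCa dL) r eq dR =
    □◇′ s (◇boxed-++-boxed P P′ p r) (All.++⁺ eA (Equivs′-trans cC daC dCa (Equivs⇒Equivs′ eq)))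
      (subst (λ L → ⊢ b ∷ L ⇒ _) (sym (map-++ _ P P′)) (cD dL (h , dR)))
  cut-□◇ s _ _ (by◇Rid s′ _ _ _ _ _) _ _ _ = ⊥-elim (plain⇒¬id s s′)
  cut-□◇ {h} {Δ = Δ} _ cC cD (bymp◇ m dC dD) r eq dR =
    weakenR-any′ Δ (mp□-fire m cC dC r eq (cD dD (h , dR)))

  cut-□◇id : ∀ {h Γ Γ′ G P′ C D Δ} → HasId S → Cut C → Cut D → RightIntro Γ (C ◇→ D) →
             Γ′ ↭ G ++ boxes P′ → Equivs S h C P′ → ⊢[ h ] C ∷ D ∷ conseqs P′ ⇒ nothing → ⊢ Γ ++ Γ′ ⇒ Δ
  cut-□◇id {h} {P′ = P′} {C} {D} _ cC cD (by◇Rid {P = P} {a} {b} s p eA daC dCa dL) r eq dR =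
    □◇id′ s (◇boxed-++-boxed P P′ p r) (All.++⁺ eA (Equivs′-trans cC daC dCa (Equivs⇒Equivs′ eq)))
      (subst (λ L → ⊢ a ∷ b ∷ L ⇒ _) (sym (map-++ _ P P′))
        (contract′ (cC daC (⊢′-resp-↭ (shift C (a ∷ b ∷ conseqs P) (conseqs P′))
          (cD dL (h , ⊢-resp-↭ (swap C D refl) dR))))))
  cut-□◇id s _ _ (by◇R s′ _ _ _ _ _) _ _ _ = ⊥-elim (plain⇒¬id s′ s)
  cut-□◇id {h} {Γ} {P′ = P′} {C} {D} {Δ} _ cC cD (bymp◇ m dC dD) r eq dR =
    weakenR-any′ Δ (mp□-fire m cC dC r eq (contract-++′ Γ (cC dC (⊢′-resp-↭ (shift C Γ (conseqs P′))
      (cD dD (h , ⊢-resp-↭ (swap C D refl) dR))))))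

  merge-□R : ∀ {h Γ Γ′ G P′ P₀ A B C D} → HasPlain S → Cut A → Cut B → RightIntro Γ (A □→ B) →
             Γ′ ↭ G ++ boxes P₀ → P′ ↭ (A , B) ∷ P₀ → Equivs S h C P′ → ⊢[ h ] conseqs P′ ⇒ just D →
             ⊢ Γ ++ Γ′ ⇒ just (C □→ D)
  merge-□R {P₀ = P₀} _ cA cB (by□R {P = P} s p eA dB) r q eq d =
    □R′ s (boxed-++-boxed P P₀ p r) (Equivs-merge cA q eq eA) (conseqs-merge cB dB [] d q)
  merge-□R s _ _ (by□Rid s′ _ _ _) _ _ _ _ = ⊥-elim (plain⇒¬id s s′)

  merge-□Rid : ∀ {h Γ Γ′ G P′ P₀ A B C D} → HasId S → Cut A → Cut B → RightIntro Γ (A □→ B) →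
               Γ′ ↭ G ++ boxes P₀ → P′ ↭ (A , B) ∷ P₀ → Equivs S h C P′ → ⊢[ h ] C ∷ conseqs P′ ⇒ just D →
               ⊢ Γ ++ Γ′ ⇒ just (C □→ D)
  merge-□Rid {P₀ = P₀} _ cA cB (by□Rid {P = P} s p eA dB) r q eq d =
    □Rid′ s (boxed-++-boxed P P₀ p r) (Equivs-merge cA q eq eA) (conseqs-mergeId cA cB q eq dB [] d)
  merge-□Rid s _ _ (by□R s′ _ _ _) _ _ _ _ = ⊥-elim (plain⇒¬id s′ s)

  merge-◇R : ∀ {h Γ Γ′ G P′ P₀ A B C D ζ θ} → HasPlain S → Cut A → Cut B → RightIntro Γ (A □→ B) →
             Γ′ ↭ (C ◇→ D) ∷ (G ++ boxes P₀) → P′ ↭ (A , B) ∷ P₀ → Equivs S h C P′ →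
             ⊢[ h ] [ C ] ⇒ just ζ → ⊢[ h ] [ ζ ] ⇒ just C → ⊢[ h ] D ∷ conseqs P′ ⇒ just θ →
             ⊢ Γ ++ Γ′ ⇒ just (ζ ◇→ θ)
  merge-◇R {h} {P₀ = P₀} {D = D} _ cA cB (by□R {P = P} s p eA dB) r q eq d₁ d₂ d₃ =
    ◇R′ s (boxed-++-◇boxed P P₀ p r) (Equivs-merge cA q eq eA) (h , d₁) (h , d₂)
      (conseqs-merge cB dB [ D ] d₃ q)
  merge-◇R s _ _ (by□Rid s′ _ _ _) _ _ _ _ _ _ = ⊥-elim (plain⇒¬id s s′)

  merge-◇Rid : ∀ {h Γ Γ′ G P′ P₀ A B C D ζ θ} → HasId S → Cut A → Cut B → RightIntro Γ (A □→ B) →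
               Γ′ ↭ (C ◇→ D) ∷ (G ++ boxes P₀) → P′ ↭ (A , B) ∷ P₀ → Equivs S h C P′ →
               ⊢[ h ] [ C ] ⇒ just ζ → ⊢[ h ] [ ζ ] ⇒ just C → ⊢[ h ] C ∷ D ∷ conseqs P′ ⇒ just θ →
               ⊢ Γ ++ Γ′ ⇒ just (ζ ◇→ θ)
  merge-◇Rid {h} {P₀ = P₀} {D = D} _ cA cB (by□Rid {P = P} s p eA dB) r q eq d₁ d₂ d₃ =
    ◇Rid′ s (boxed-++-◇boxed P P₀ p r) (Equivs-merge cA q eq eA) (h , d₁) (h , d₂)
      (conseqs-mergeId cA cB q eq dB [ D ] d₃)
  merge-◇Rid s _ _ (by□R s′ _ _ _) _ _ _ _ _ _ = ⊥-elim (plain⇒¬id s′ s)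

  merge-□◇ : ∀ {h Γ Γ′ G P′ P₀ A B C D Δ} → HasPlain S → Cut A → Cut B → RightIntro Γ (A □→ B) →
             Γ′ ↭ (C ◇→ D) ∷ (G ++ boxes P₀) → P′ ↭ (A , B) ∷ P₀ → Equivs S h C P′ →
             ⊢[ h ] D ∷ conseqs P′ ⇒ nothing → ⊢ Γ ++ Γ′ ⇒ Δ
  merge-□◇ {P₀ = P₀} {D = D} _ cA cB (by□R {P = P} s p eA dB) r q eq d =
    □◇′ s (boxed-++-◇boxed P P₀ p r) (Equivs-merge cA q eq eA) (conseqs-merge cB dB [ D ] d q)
  merge-□◇ s _ _ (by□Rid s′ _ _ _) _ _ _ _ = ⊥-elim (plain⇒¬id s s′)

  merge-□◇id : ∀ {h Γ Γ′ G P′ P₀ A B C D Δ} → HasId S → Cut A → Cut B → RightIntro Γ (A □→ B) →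
               Γ′ ↭ (C ◇→ D) ∷ (G ++ boxes P₀) → P′ ↭ (A , B) ∷ P₀ → Equivs S h C P′ →
               ⊢[ h ] C ∷ D ∷ conseqs P′ ⇒ nothing → ⊢ Γ ++ Γ′ ⇒ Δ
  merge-□◇id {P₀ = P₀} {D = D} _ cA cB (by□Rid {P = P} s p eA dB) r q eq d =
    □◇id′ s (boxed-++-◇boxed P P₀ p r) (Equivs-merge cA q eq eA) (conseqs-mergeId cA cB q eq dB [ D ] d)
  merge-□◇id s _ _ (by□R s′ _ _ _) _ _ _ _ = ⊥-elim (plain⇒¬id s′ s)

  cutRight : ∀ φ → CutBelow φ → ∀ h {Γ Γ′ Δ} → RightIntro Γ φ → ⊢[ h ] φ ∷ Γ′ ⇒ Δ → ⊢ Γ ++ Γ′ ⇒ Δ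
  cutRight φ ih h {Γ} v (init p) with ∷↭∷⁻ p
  ... | inj₁ (refl , _) with v
  ...   | ()
  cutRight φ ih h {Γ} v (init p) | inj₂ (_ , r , _) = 0 , init (++-insert Γ r)
  cutRight φ ih h {Γ} v (⊥L p) with ∷↭∷⁻ p
  ... | inj₁ (refl , _) with v
  ...   | ()
  cutRight φ ih h {Γ} v (⊥L p) | inj₂ (_ , r , _) = 0 , ⊥L (++-insert Γ r)
  cutRight φ ih (suc h) {Γ} v (∧L {φ = a} {b} p d) with ∷↭∷⁻ p
  ... | inj₁ (refl , r) = cut-∧ (proj₁ ih) (proj₂ ih) v d r
  ... | inj₂ (_ , r₁ , r₂) = ∧L′ (++-insert Γ r₁) (⊢′-resp-↭ (shifts Γ (a ∷ b ∷ []))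
          (cutRight φ ih h v (⊢-resp-↭ (↭-trans (prep a (prep b r₂)) (↭-sym (shifts [ φ ] (a ∷ b ∷ [])))) d)))
  cutRight φ ih (suc h) {Γ} v (∨L {φ = a} {b} p d e) with ∷↭∷⁻ p
  ... | inj₁ (refl , r) = cut-∨ (proj₁ ih) (proj₂ ih) v d e r
  ... | inj₂ (K , r₁ , r₂) = ∨L′ (++-insert Γ r₁)
          (⊢′-resp-↭ (shift a Γ K) (cutRight φ ih h v (⊢-resp-↭ (↭-trans (prep a r₂) (swap a φ refl)) d)))
          (⊢′-resp-↭ (shift b Γ K) (cutRight φ ih h v (⊢-resp-↭ (↭-trans (prep b r₂) (swap b φ refl)) e)))
  cutRight φ ih (suc h) {Γ} v (⊃L {ψ = b} p d e) with ∷↭∷⁻ p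
  ... | inj₁ (refl , r) = cut-⊃ (proj₁ ih) (proj₂ ih) v (cutRight _ ih h v d) e r
  ... | inj₂ (K , r₁ , r₂) = ⊃L′ (++-insert Γ r₁) (cutRight φ ih h v d)
          (⊢′-resp-↭ (shift b Γ K) (cutRight φ ih h v (⊢-resp-↭ (↭-trans (prep b r₂) (swap b φ refl)) e)))
  cutRight φ ih (suc h) {Γ} {Γ′} v (mp□ {ψ = b} s p d e) with ∷↭∷⁻ p
  ... | inj₁ (refl , _) = cut-mp□ s (proj₁ ih) (proj₂ ih) v (cutRight _ ih h v d)
          (⊢′-resp-↭ (shift b Γ Γ′) (cutRight _ ih h v (⊢-resp-↭ (swap b _ refl) e)))
  ... | inj₂ (_ , r , _) = mp□′ s (++-insert Γ r) (cutRight φ ih h v d)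
          (⊢′-resp-↭ (shift b Γ Γ′) (cutRight φ ih h v (⊢-resp-↭ (swap b φ refl) e)))
  cutRight φ ih (suc h) v (∧R d e) = ∧R′ (cutRight φ ih h v d) (cutRight φ ih h v e)
  cutRight φ ih (suc h) v (∨R₁ d) = ∨R₁′ (cutRight φ ih h v d)
  cutRight φ ih (suc h) v (∨R₂ d) = ∨R₂′ (cutRight φ ih h v d)
  cutRight φ ih (suc h) {Γ} {Γ′} v (⊃R {φ = a} d) =
    ⊃R′ (⊢′-resp-↭ (shift a Γ Γ′) (cutRight φ ih h v (⊢-resp-↭ (swap a φ refl) d)))
  cutRight φ ih (suc h) v (mp◇ s d e) = mp◇′ s (cutRight φ ih h v d) (cutRight φ ih h v e)
  cutRight φ ih (suc h) {Γ} v (□R {Γ = G} s p eq d) with ∷↭boxed⁻ {Gc = G} p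
  ... | inj₁ (_ , r) = suc h , □R s (++-boxed Γ r) eq d
  ... | inj₂ (_ , _ , _ , refl , q , r) = merge-□R s (proj₁ ih) (proj₂ ih) v r q eq d
  cutRight φ ih (suc h) {Γ} v (□Rid {Γ = G} s p eq d) with ∷↭boxed⁻ {Gc = G} p
  ... | inj₁ (_ , r) = suc h , □Rid s (++-boxed Γ r) eq d
  ... | inj₂ (_ , _ , _ , refl , q , r) = merge-□Rid s (proj₁ ih) (proj₂ ih) v r q eq d
  cutRight φ ih (suc h) {Γ} v (◇R {Γ = G} s p eq d₁ d₂ d₃) with ∷↭◇boxed⁻ {Gc = G} p
  ... | inj₁ (refl , r) = cut-◇R s (proj₁ ih) (proj₂ ih) v r eq d₁ d₂ d₃
  ... | inj₂ (inj₁ (_ , r)) = suc h , ◇R s (++-◇boxed Γ r) eq d₁ d₂ d₃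
  ... | inj₂ (inj₂ (_ , _ , _ , refl , q , r)) = merge-◇R s (proj₁ ih) (proj₂ ih) v r q eq d₁ d₂ d₃
  cutRight φ ih (suc h) {Γ} v (◇Rid {Γ = G} s p eq d₁ d₂ d₃) with ∷↭◇boxed⁻ {Gc = G} p
  ... | inj₁ (refl , r) = cut-◇Rid s (proj₁ ih) (proj₂ ih) v r eq d₁ d₂ d₃
  ... | inj₂ (inj₁ (_ , r)) = suc h , ◇Rid s (++-◇boxed Γ r) eq d₁ d₂ d₃
  ... | inj₂ (inj₂ (_ , _ , _ , refl , q , r)) = merge-◇Rid s (proj₁ ih) (proj₂ ih) v r q eq d₁ d₂ d₃
  cutRight φ ih (suc h) {Γ} v (□◇ {Γ = G} s p eq d) with ∷↭◇boxed⁻ {Gc = G} p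
  ... | inj₁ (refl , r) = cut-□◇ s (proj₁ ih) (proj₂ ih) v r eq d
  ... | inj₂ (inj₁ (_ , r)) = suc h , □◇ s (++-◇boxed Γ r) eq d
  ... | inj₂ (inj₂ (_ , _ , _ , refl , q , r)) = merge-□◇ s (proj₁ ih) (proj₂ ih) v r q eq d
  cutRight φ ih (suc h) {Γ} v (□◇id {Γ = G} s p eq d) with ∷↭◇boxed⁻ {Gc = G} p
  ... | inj₁ (refl , r) = cut-□◇id s (proj₁ ih) (proj₂ ih) v r eq d
  ... | inj₂ (inj₁ (_ , r)) = suc h , □◇id s (++-◇boxed Γ r) eq d
  ... | inj₂ (inj₂ (_ , _ , _ , refl , q , r)) = merge-□◇id s (proj₁ ih) (proj₂ ih) v r q eq d

  -- Cut is first permuted up the left premiss until φ is introduced on the right there.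
  cutLeft : ∀ φ → CutBelow φ → ∀ {h₁ h₂ Γ Γ′ Δ} → ⊢[ h₁ ] Γ ⇒ just φ → ⊢[ h₂ ] φ ∷ Γ′ ⇒ Δ → ⊢ Γ ++ Γ′ ⇒ Δ
  cutLeft φ ih {Γ′ = Γ′} (init {Γ = G} p) e =
    _ , ⊢-resp-↭ (↭-trans (shift _ G Γ′) (↭-sym (++⁺ʳ Γ′ p))) (weakenLˡ G e)
  cutLeft φ ih {Γ′ = Γ′} (⊥L p) e = 0 , ⊥L (++⁺ʳ Γ′ p)
  cutLeft φ ih {Γ′ = Γ′} (∧L p d) e = ∧L′ (++⁺ʳ Γ′ p) (cutLeft φ ih d e)
  cutLeft φ ih {Γ′ = Γ′} (∨L p d₁ d₂) e = ∨L′ (++⁺ʳ Γ′ p) (cutLeft φ ih d₁ e) (cutLeft φ ih d₂ e)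
  cutLeft φ ih {Γ′ = Γ′} (⊃L p d₁ d₂) e = ⊃L′ (++⁺ʳ Γ′ p) (weakenLʳ′ Γ′ (_ , d₁)) (cutLeft φ ih d₂ e)
  cutLeft φ ih {Γ′ = Γ′} (mp□ s p d₁ d₂) e = mp□′ s (++⁺ʳ Γ′ p) (weakenLʳ′ Γ′ (_ , d₁)) (cutLeft φ ih d₂ e)
  cutLeft φ ih {Γ′ = Γ′} (□◇ {Γ = G} s p eq d) e =
    _ , □◇ {Γ = G ++ Γ′} s (↭-trans (++⁺ʳ Γ′ p) (prep _ (xy∙z≈xz∙y G _ Γ′))) eq d
  cutLeft φ ih {Γ′ = Γ′} (□◇id {Γ = G} s p eq d) e =
    _ , □◇id {Γ = G ++ Γ′} s (↭-trans (++⁺ʳ Γ′ p) (prep _ (xy∙z≈xz∙y G _ Γ′))) eq d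
  cutLeft φ ih {h₂ = h₂} (∧R d₁ d₂) e = cutRight φ ih h₂ (by∧R (_ , d₁) (_ , d₂)) e
  cutLeft φ ih {h₂ = h₂} (∨R₁ d) e = cutRight φ ih h₂ (by∨R₁ (_ , d)) e
  cutLeft φ ih {h₂ = h₂} (∨R₂ d) e = cutRight φ ih h₂ (by∨R₂ (_ , d)) e
  cutLeft φ ih {h₂ = h₂} (⊃R d) e = cutRight φ ih h₂ (by⊃R (_ , d)) e
  cutLeft φ ih {h₂ = h₂} (□R s p eq d) e = cutRight φ ih h₂ (by□R s p (Equivs⇒Equivs′ eq) (_ , d)) e
  cutLeft φ ih {h₂ = h₂} (□Rid s p eq d) e = cutRight φ ih h₂ (by□Rid s p (Equivs⇒Equivs′ eq) (_ , d)) e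
  cutLeft φ ih {h₂ = h₂} (◇R s p eq d₁ d₂ d₃) e =
    cutRight φ ih h₂ (by◇R s p (Equivs⇒Equivs′ eq) (_ , d₁) (_ , d₂) (_ , d₃)) e
  cutLeft φ ih {h₂ = h₂} (◇Rid s p eq d₁ d₂ d₃) e =
    cutRight φ ih h₂ (by◇Rid s p (Equivs⇒Equivs′ eq) (_ , d₁) (_ , d₂) (_ , d₃)) e
  cutLeft φ ih {h₂ = h₂} (mp◇ s d₁ d₂) e = cutRight φ ih h₂ (bymp◇ s (_ , d₁) (_ , d₂)) e

  cut : ∀ φ → Cut φ
  cut φ (_ , d) (_ , e) = cutLeft φ (cutBelow φ) d e
    where
    cutBelow : ∀ φ → CutBelow φ
    cutBelow (var _) = _
    cutBelow ⊥' = _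
    cutBelow (a ∧' b) = (λ {_} {_} {_} → cut a) , (λ {_} {_} {_} → cut b)
    cutBelow (a ∨' b) = (λ {_} {_} {_} → cut a) , (λ {_} {_} {_} → cut b)
    cutBelow (a ⊃ b) = (λ {_} {_} {_} → cut a) , (λ {_} {_} {_} → cut b)
    cutBelow (a □→ b) = (λ {_} {_} {_} → cut a) , (λ {_} {_} {_} → cut b)
    cutBelow (a ◇→ b) = (λ {_} {_} {_} → cut a) , (λ {_} {_} {_} → cut b)

open Structural

theorem10 : (S : Calculus) → HP-wL S × HP-wR S × HP-c S × Adm-cut S
theorem10 S = (λ _ _ _ φ → weakenL S φ)
            , (λ _ _ φ → weakenR S φ)
            , (λ _ _ _ _ → contract S)
            , (λ _ _ _ φ → cut S φ)
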